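{- For every integer $n\ge 0$, the following identity of polynomials in $x$ holds: \[ H_{n}(x)=\sum_{k=0}^{n}\left( \left(2^{k+2}k+2^{k+1}\right)\sum_{\substack{0\le j\le n\\ j-k\equiv 0 \pmod 2}}\frac{2^{j}\binom{n}{j}\,j!\left(\frac{j+k+2}{2}\right)!}{(j+k+2)!\left(\frac{j-k}{2}\right)!}\,H_{n-j}\right)P_{k}(x). \]
   Context: $P_k(x)$ denotes the $k$-th Legendre polynomial, defined by $\frac{1}{\sqrt{1-2xt+t^2}}=\sum_{k\ge 0}P_k(x)t^k$ (equivalently $P_k(x)=\frac{1}{k!2^k}\frac{d^k}{dx^k}(x^2-1)^k$). The Hermite polynomials $H_n(x)$ are defined by $e^{2xt-t^2}=\sum_{n\ge 0}H_n(x)\frac{t^n}{n!}$, and $H_m:=H_m(0)$ denotes the $m$-th Hermite number. Convention: terms in the inner sum with $j<k$ are taken to be $0$, i.e. $1/m!=0$ for negative integers $m$. -}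

module Defs where

open import Data.Nat as ℕ using (ℕ; zero; suc; _∸_; _<ᵇ_; _≡ᵇ_)
open import Data.Nat using (_!)
open import Data.Nat.Combinatorics using (_C_)
open import Relation.Binary.PropositionalEquality using (_≡_)
open import Data.Nat.DivMod using (_/_; _%_)
open import Data.Integer using (+_)
open import Data.Rational as ℚ using (ℚ; 0ℚ; 1ℚ; _+_; _*_; -_)
open import Data.Bool using (if_then_else_)

⟦_⟧ : ℕ → ℚ
⟦ n ⟧ = + n ℚ./ 1

-- a / b as a rational; only used with b ≥ 1 (factorials), b = 0 gives 0
frac : ℕ → ℕ → ℚ
frac a zero    = 0ℚ
frac a (suc b) = + a ℚ./ suc b

sumTo : ℕ → (ℕ → ℚ) → ℚ
sumTo zero    f = f 0
sumTo (suc n) f = sumTo n f + f (suc n)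

-- Polynomials over ℚ in one variable x, as coefficient sequences
-- (coefficient of x^i); all polynomials below have finite support.
Poly : Set
Poly = ℕ → ℚ

_≈ₚ_ : Poly → Poly → Set
p ≈ₚ q = ∀ i → p i ≡ q i

constP : ℚ → Poly
constP c zero    = c
constP c (suc i) = 0ℚ

X : Poly
X 1 = 1ℚ
X _ = 0ℚ

_+ₚ_ : Poly → Poly → Poly
(p +ₚ q) i = p i + q i

_*ₚ_ : Poly → Poly → Poly
(p *ₚ q) i = sumTo i (λ a → p a * q (i ∸ a))

_·ₚ_ : ℚ → Poly → Poly
(c ·ₚ p) i = c * p i

D : Poly → Poly
D p i = ⟦ suc i ⟧ * p (suc i)

iter : ℕ → (Poly → Poly) → Poly → Poly
iter zero    f p = p
iter (suc k) f p = f (iter k f p)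

_^ₚ_ : Poly → ℕ → Poly
p ^ₚ zero  = constP 1ℚ
p ^ₚ suc k = p *ₚ (p ^ₚ k)

-- Legendre polynomial via Rodrigues' formula:
-- P_k(x) = 1/(k! 2^k) d^k/dx^k (x^2-1)^k
Legendre : ℕ → Poly
Legendre k = frac 1 (k ! ℕ.* 2 ℕ.^ k) ·ₚ iter k D (((X *ₚ X) +ₚ constP (- 1ℚ)) ^ₚ k)

-- Hermite polynomials (physicists'), generating function e^{2xt-t^2}:
-- H_0 = 1, H_1 = 2x, H_{n+2} = 2x H_{n+1} - 2(n+1) H_n
Hermite : ℕ → Poly
Hermite zero          = constP 1ℚ
Hermite (suc zero)    = ⟦ 2 ⟧ ·ₚ X
Hermite (suc (suc n)) =
  ((⟦ 2 ⟧ ·ₚ X) *ₚ Hermite (suc n)) +ₚ ((- ⟦ 2 ℕ.* suc n ⟧) ·ₚ Hermite n)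

HermiteNum : ℕ → ℚ
HermiteNum m = Hermite m 0

term : ℕ → ℕ → ℕ → ℚ
term n k j =
  if j <ᵇ k then 0ℚ
  else if ((j ∸ k) % 2) ≡ᵇ 0 then
    frac (2 ℕ.^ j ℕ.* (n C j) ℕ.* (j !) ℕ.* (((j ℕ.+ k ℕ.+ 2) / 2) !))
         (((j ℕ.+ k ℕ.+ 2) !) ℕ.* (((j ∸ k) / 2) !))
      * HermiteNum (n ∸ j)
  else 0ℚ

coeff : ℕ → ℕ → ℚ
coeff n k = ⟦ 2 ℕ.^ (k ℕ.+ 2) ℕ.* k ℕ.+ 2 ℕ.^ (k ℕ.+ 1) ⟧ * sumTo n (term n k)

sumPoly : ℕ → (ℕ → Poly) → Poly
sumPoly n f i = sumTo n (λ k → f k i)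

module Submission where

-- Write c(n,j) = 2^j (n choose j) H_{n-j}.  The proof rests on two
-- coefficient-level facts.
--
--  * Hermite coefficients: the coefficient of x^j in H_n is c(n,j)
--    (that is, H_n(x) = Σ_j (n choose j) (2x)^j H_{n-j}); proved by
--    induction from the three-term recurrence.
--  * Monomials in the Legendre basis: x^j = Σ_k W_k g(j,k) P_k(x), where
--    W_k = 2^{k+2} k + 2^{k+1} and g(j,k) is the inner fraction of the
--    theorem.  On coefficients: Σ_k W_k g(j,k) [x^i]P_k = δ_{ij}.  The
--    coefficients of P_k are explicit by Rodrigues' formula, and for
--    j = i + 2s the sum (over k = i + 2t) is an alternating telescoping
--    sum of explicit factorial fractions.
--
-- The coefficient of P_k in the theorem is W_k Σ_j c(n,j) g(j,k), so
-- after exchanging the two finite sums the coefficient of x^i on the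
-- right-hand side is Σ_j c(n,j) δ_{ij} = c(n,i), which is the coefficient
-- of x^i in H_n.

open import Defs
open import Data.Bool using (Bool; true; false; if_then_else_)
open import Data.Empty using (⊥; ⊥-elim)
open import Data.Integer as ℤ using (+_)
import Data.Integer.Properties as ℤP
open import Data.List using (_∷_; [])
open import Data.Maybe using (Maybe; just; nothing)
open import Data.Nat as ℕ
  using (ℕ; zero; suc; _∸_; _!; _^_; _<ᵇ_; _≡ᵇ_; _≤_; _<_; z≤n; s≤s)
open import Data.Nat.Combinatorics
  using (_C_; nCk≡n!/k![n-k]!; nCk+nC[k+1]≡[n+1]C[k+1]; nCn≡1; k![n∸k]!∣n!)
open import Data.Nat.DivMod using (_/_; _%_; m*n/n≡m; m/n*n≡m; m*n%n≡0; [m+kn]%n≡m%n)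
import Data.Nat.Properties as ℕP
import Data.Nat.Tactic.RingSolver as ℕ-Ring
open import Data.Product using (Σ-syntax; _,_)
open import Data.Rational as ℚ using (ℚ; 0ℚ; 1ℚ; _+_; _*_; -_)
import Data.Rational.Properties as ℚP
open import Data.Rational.Unnormalised as ℚᵘ using (mkℚᵘ; *≡*)
import Data.Rational.Unnormalised.Properties as ℚᵘP
open import Data.Sum using (_⊎_; inj₁; inj₂)
open import Relation.Binary.PropositionalEquality hiding (J)
open import Relation.Nullary using (Dec; yes; no)
open import Tactic.RingSolver using (solve-∀)
open import Tactic.RingSolver.Core.AlmostCommutativeRing
  using (AlmostCommutativeRing; fromCommutativeRing)

open ≡-Reasoning

-- ℚ as a ring for the reflective ring solver (with decidable zero test on
-- coefficients, so that numeric coefficients are normalised).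
ℚ-ring : AlmostCommutativeRing _ _
ℚ-ring = fromCommutativeRing ℚP.+-*-commutativeRing isZero
  where
  isZero : (x : ℚ) → Maybe (0ℚ ≡ x)
  isZero x with x ℚP.≟ 0ℚ
  ... | yes x≡0 = just (sym x≡0)
  ... | no _    = nothing

infixl 7 _⊛_
_⊛_ : ∀ {m n} → 0 < m → 0 < n → 0 < m ℕ.* n
_⊛_ {suc m} {suc n} _ _ = s≤s z≤n

!-pos : ∀ n → 0 < n !
!-pos = ℕP.1≤n!

suc-pos : ∀ n → 0 < suc n
suc-pos _ = s≤s z≤n

-- frac a (1+b) is the image of the unnormalised fraction a/(1+b).
private
  fracᵘ : ℕ → ℕ → ℚᵘ.ℚᵘ
  fracᵘ a b = mkℚᵘ (+ a) b

frac-cross : ∀ {a b c d} → 0 < b → 0 < d → a ℕ.* d ≡ c ℕ.* b → frac a b ≡ frac c d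
frac-cross {a} {suc b} {c} {suc d} _ _ eq =
  ℚP.fromℚᵘ-cong {fracᵘ a b} {fracᵘ c d} (*≡* (trans (sym (ℤP.pos-* a (suc d))) (trans (cong +_ eq) (ℤP.pos-* c (suc b)))))

-- Product of fractions (no side condition: frac a 0 = 0).
frac-* : ∀ a b c d → frac a b * frac c d ≡ frac (a ℕ.* c) (b ℕ.* d)
frac-* a zero    c d       = ℚP.*-zeroˡ (frac c d)
frac-* a (suc b) c zero    = trans (ℚP.*-zeroʳ (frac a (suc b))) (cong (frac (a ℕ.* c)) (sym (ℕP.*-zeroʳ (suc b))))
frac-* a (suc b) c (suc d) = begin
  p * q                                     ≡⟨ sym (ℚP.fromℚᵘ-toℚᵘ (p * q)) ⟩
  ℚ.fromℚᵘ (ℚ.toℚᵘ (p * q))                 ≡⟨ ℚP.fromℚᵘ-cong (ℚᵘP.≃-trans (ℚP.toℚᵘ-homo-* p q) (ℚᵘP.*-cong (ℚP.toℚᵘ-fromℚᵘ x) (ℚP.toℚᵘ-fromℚᵘ y))) ⟩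
  ℚ.fromℚᵘ (x ℚᵘ.* y)                       ≡⟨ ℚP./-cong (sym (ℤP.pos-* a c)) refl ⟩
  frac (a ℕ.* c) (suc b ℕ.* suc d)          ∎
  where
  x y : ℚᵘ.ℚᵘ
  x = fracᵘ a b
  y = fracᵘ c d
  p q : ℚ
  p = ℚ.fromℚᵘ x
  q = ℚ.fromℚᵘ y

frac-+ : ∀ {a b c d} → 0 < b → 0 < d → frac a b + frac c d ≡ frac (a ℕ.* d ℕ.+ c ℕ.* b) (b ℕ.* d)
frac-+ {a} {suc b} {c} {suc d} _ _ = begin
  p + q                                     ≡⟨ sym (ℚP.fromℚᵘ-toℚᵘ (p + q)) ⟩
  ℚ.fromℚᵘ (ℚ.toℚᵘ (p + q))                 ≡⟨ ℚP.fromℚᵘ-cong (ℚᵘP.≃-trans (ℚP.toℚᵘ-homo-+ p q) (ℚᵘP.+-cong (ℚP.toℚᵘ-fromℚᵘ x) (ℚP.toℚᵘ-fromℚᵘ y))) ⟩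
  ℚ.fromℚᵘ (x ℚᵘ.+ y)                       ≡⟨ ℚP./-cong numerator refl ⟩
  frac (a ℕ.* suc d ℕ.+ c ℕ.* suc b) (suc b ℕ.* suc d) ∎
  where
  x y : ℚᵘ.ℚᵘ
  x = fracᵘ a b
  y = fracᵘ c d
  p q : ℚ
  p = ℚ.fromℚᵘ x
  q = ℚ.fromℚᵘ y
  numerator : + a ℤ.* + suc d ℤ.+ + c ℤ.* + suc b ≡ + (a ℕ.* suc d ℕ.+ c ℕ.* suc b)
  numerator = sym (trans (ℤP.pos-+ (a ℕ.* suc d) (c ℕ.* suc b))
                         (cong₂ ℤ._+_ (ℤP.pos-* a (suc d)) (ℤP.pos-* c (suc b))))

frac-zero : ∀ b → frac 0 b ≡ 0ℚ
frac-zero zero    = refl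
frac-zero (suc b) = frac-cross {0} {suc b} {0} {1} (suc-pos b) (suc-pos 0) refl

⟦⟧-+ : ∀ m n → ⟦ m ℕ.+ n ⟧ ≡ ⟦ m ⟧ + ⟦ n ⟧
⟦⟧-+ m n = sym (trans (frac-+ {m} {1} {n} {1} (suc-pos 0) (suc-pos 0))
                      (cong (λ x → frac x 1) (cong₂ ℕ._+_ (ℕP.*-identityʳ m) (ℕP.*-identityʳ n))))

⟦⟧-* : ∀ m n → ⟦ m ℕ.* n ⟧ ≡ ⟦ m ⟧ * ⟦ n ⟧
⟦⟧-* m n = sym (frac-* m 1 n 1)

sgn : ℕ → ℚ
sgn zero    = 1ℚ
sgn (suc n) = - sgn n

sgn-+ : ∀ a b → sgn (a ℕ.+ b) ≡ sgn a * sgn b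
sgn-+ zero    b = sym (ℚP.*-identityˡ (sgn b))
sgn-+ (suc a) b = trans (cong -_ (sgn-+ a b)) (ℚP.neg-distribˡ-* (sgn a) (sgn b))

sgn-even : ∀ a → sgn (a ℕ.+ a) ≡ 1ℚ
sgn-even a = trans (sgn-+ a a) (square a)
  where
  neg-square : ∀ (x : ℚ) → (- x) * (- x) ≡ x * x
  neg-square = solve-∀ ℚ-ring
  square : ∀ a → sgn a * sgn a ≡ 1ℚ
  square zero    = refl
  square (suc a) = trans (neg-square (sgn a)) (square a)

-- i +2× t = i + 2t, defined so that stepping t by one adds two successors.
infixl 6 _+2×_
_+2×_ : ℕ → ℕ → ℕ
i +2× zero  = i
i +2× suc t = suc (suc (i +2× t))

+2×-spec : ∀ i t → i +2× t ≡ i ℕ.+ (t ℕ.+ t)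
+2×-spec i zero    = sym (ℕP.+-identityʳ i)
+2×-spec i (suc t) = begin
  suc (suc (i +2× t))        ≡⟨ cong (λ m → suc (suc m)) (+2×-spec i t) ⟩
  suc (suc (i ℕ.+ (t ℕ.+ t))) ≡⟨ lemma i t ⟩
  i ℕ.+ (suc t ℕ.+ suc t)    ∎
  where
  lemma : ∀ i t → suc (suc (i ℕ.+ (t ℕ.+ t))) ≡ i ℕ.+ (suc t ℕ.+ suc t)
  lemma = ℕ-Ring.solve-∀

+2×-+ : ∀ i t d → i +2× (t ℕ.+ d) ≡ (i +2× t) +2× d
+2×-+ i zero    d = refl
+2×-+ i (suc t) d = begin
  i +2× (suc t ℕ.+ d)          ≡⟨ cong (i +2×_) (sym (ℕP.+-suc t d)) ⟩
  i +2× (t ℕ.+ suc d)          ≡⟨ +2×-+ i t (suc d) ⟩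
  (i +2× t) +2× suc d          ≡⟨ shift (i +2× t) d ⟩
  (i +2× suc t) +2× d          ∎
  where
  shift : ∀ m d → m +2× suc d ≡ suc (suc m) +2× d
  shift m zero    = refl
  shift m (suc d) = cong (λ x → suc (suc x)) (shift m d)

parity : ∀ n → Σ[ u ∈ ℕ ] n ≡ 0 +2× u ⊎ Σ[ u ∈ ℕ ] n ≡ suc (0 +2× u)
parity zero = inj₁ (0 , refl)
parity (suc n) with parity n
... | inj₁ (u , refl) = inj₂ (u , refl)
... | inj₂ (u , refl) = inj₁ (suc u , refl)

even≢odd : ∀ a b → 0 +2× a ≢ suc (0 +2× b)
even≢odd zero    b       ()
even≢odd (suc a) zero    ()
even≢odd (suc a) (suc b) eq = even≢odd a b (ℕP.suc-injective (ℕP.suc-injective eq))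

sumTo-cong : ∀ n {f g : ℕ → ℚ} → (∀ k → k ≤ n → f k ≡ g k) → sumTo n f ≡ sumTo n g
sumTo-cong zero    eq = eq 0 z≤n
sumTo-cong (suc n) eq = cong₂ _+_ (sumTo-cong n (λ k k≤n → eq k (ℕP.m≤n⇒m≤1+n k≤n))) (eq (suc n) ℕP.≤-refl)

sumTo-zero : ∀ n {f : ℕ → ℚ} → (∀ k → k ≤ n → f k ≡ 0ℚ) → sumTo n f ≡ 0ℚ
sumTo-zero zero    eq = eq 0 z≤n
sumTo-zero (suc n) eq = cong₂ _+_ (sumTo-zero n (λ k k≤n → eq k (ℕP.m≤n⇒m≤1+n k≤n))) (eq (suc n) ℕP.≤-refl)

sumTo-+ : ∀ n (f g : ℕ → ℚ) → sumTo n (λ k → f k + g k) ≡ sumTo n f + sumTo n g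
sumTo-+ zero    f g = refl
sumTo-+ (suc n) f g = trans (cong (_+ (f (suc n) + g (suc n))) (sumTo-+ n f g))
                            (interchange (sumTo n f) (sumTo n g) (f (suc n)) (g (suc n)))
  where
  interchange : ∀ (a b c d : ℚ) → (a + b) + (c + d) ≡ (a + c) + (b + d)
  interchange = solve-∀ ℚ-ring

sumTo-*ˡ : ∀ n c (f : ℕ → ℚ) → sumTo n (λ k → c * f k) ≡ c * sumTo n f
sumTo-*ˡ zero    c f = refl
sumTo-*ˡ (suc n) c f = trans (cong (_+ (c * f (suc n))) (sumTo-*ˡ n c f))
                             (sym (ℚP.*-distribˡ-+ c (sumTo n f) (f (suc n))))

sumTo-*ʳ : ∀ n c (f : ℕ → ℚ) → sumTo n (λ k → f k * c) ≡ sumTo n f * c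
sumTo-*ʳ zero    c f = refl
sumTo-*ʳ (suc n) c f = trans (cong (_+ (f (suc n) * c)) (sumTo-*ʳ n c f))
                             (sym (ℚP.*-distribʳ-+ c (sumTo n f) (f (suc n))))

sumTo-swap : ∀ n m (F : ℕ → ℕ → ℚ) →
             sumTo n (λ k → sumTo m (F k)) ≡ sumTo m (λ j → sumTo n (λ k → F k j))
sumTo-swap zero    m F = refl
sumTo-swap (suc n) m F = trans (cong (_+ sumTo m (F (suc n))) (sumTo-swap n m F))
                               (sym (sumTo-+ m (λ j → sumTo n (λ k → F k j)) (F (suc n))))

sumTo-truncate : ∀ m n {f : ℕ → ℚ} → m ≤ n → (∀ k → m < k → k ≤ n → f k ≡ 0ℚ) →
                 sumTo n f ≡ sumTo m f
sumTo-truncate m zero    z≤n _ = refl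
sumTo-truncate m (suc n) {f} m≤n vanish with ℕP.m≤n⇒m<n∨m≡n m≤n
... | inj₂ refl = refl
... | inj₁ m<1+n = trans (cong₂ _+_ below (vanish (suc n) m<1+n ℕP.≤-refl)) (ℚP.+-identityʳ _)
  where
  below : sumTo n f ≡ sumTo m f
  below = sumTo-truncate m n (ℕP.<⇒≤pred m<1+n) (λ k m<k k≤n → vanish k m<k (ℕP.m≤n⇒m≤1+n k≤n))

sumTo-single : ∀ n i {f : ℕ → ℚ} → i ≤ n → (∀ k → k ≤ n → k ≢ i → f k ≡ 0ℚ) → sumTo n f ≡ f i
sumTo-single n i {f} i≤n vanish = trans (sumTo-truncate i n i≤n above) (lower i (λ k k<i → vanish k (ℕP.<⇒≤ (ℕP.<-≤-trans k<i i≤n)) (ℕP.<⇒≢ k<i)))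
  where
  above : ∀ k → i < k → k ≤ n → f k ≡ 0ℚ
  above k i<k k≤n = vanish k k≤n (ℕP.>⇒≢ i<k)
  lower : ∀ i {f : ℕ → ℚ} → (∀ k → k < i → f k ≡ 0ℚ) → sumTo i f ≡ f i
  lower zero    _      = refl
  lower (suc i) {f} vanish = trans (cong (_+ f (suc i)) (sumTo-zero i (λ k k≤i → vanish k (s≤s k≤i)))) (ℚP.+-identityˡ _)

sumTo-even-support : ∀ i s {f : ℕ → ℚ} → (∀ k → k < i → f k ≡ 0ℚ) → (∀ t → f (suc (i +2× t)) ≡ 0ℚ) →
                     sumTo (i +2× s) f ≡ sumTo s (λ t → f (i +2× t))
sumTo-even-support i zero    {f} below odd = sumTo-single i i ℕP.≤-refl (λ k k≤i k≢i → below k (ℕP.≤∧≢⇒< k≤i k≢i))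
sumTo-even-support i (suc s) {f} below odd = begin
  sumTo (i +2× s) f + f (suc (i +2× s)) + f (i +2× suc s)
    ≡⟨ cong₂ (λ x y → x + y + f (i +2× suc s)) (sumTo-even-support i s below odd) (odd s) ⟩
  sumTo s (λ t → f (i +2× t)) + 0ℚ + f (i +2× suc s)
    ≡⟨ cong (_+ f (i +2× suc s)) (ℚP.+-identityʳ (sumTo s (λ t → f (i +2× t)))) ⟩
  sumTo s (λ t → f (i +2× t)) + f (i +2× suc s) ∎

alternating-telescope : ∀ s (F A : ℕ → ℚ) → F 0 ≡ A 0 →
                        (∀ t → t < s → F (suc t) ≡ A t + A (suc t)) →
                        sumTo s (λ t → sgn t * F t) ≡ sgn s * A s
alternating-telescope s F A base step = partial s ℕP.≤-refl
  where
  cancel : ∀ (σ a b : ℚ) → σ * a + (- σ) * (a + b) ≡ (- σ) * b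
  cancel = solve-∀ ℚ-ring
  partial : ∀ t → t ≤ s → sumTo t (λ u → sgn u * F u) ≡ sgn t * A t
  partial zero    _   = cong (1ℚ *_) base
  partial (suc t) t<s = begin
    sumTo t (λ u → sgn u * F u) + (- sgn t) * F (suc t)
      ≡⟨ cong₂ (λ x y → x + (- sgn t) * y) (partial t (ℕP.<⇒≤ t<s)) (step t t<s) ⟩
    sgn t * A t + (- sgn t) * (A t + A (suc t))
      ≡⟨ cancel (sgn t) (A t) (A (suc t)) ⟩
    (- sgn t) * A (suc t) ∎

choose-factorial : ∀ a b → ((a ℕ.+ b) C a) ℕ.* (a ! ℕ.* b !) ≡ (a ℕ.+ b) !
choose-factorial a b = begin
  ((a ℕ.+ b) C a) ℕ.* (a ! ℕ.* b !)
    ≡⟨ cong₂ ℕ._*_ (nCk≡n!/k![n-k]! a≤a+b) (cong (λ m → a ! ℕ.* m !) (sym (ℕP.m+n∸m≡n a b))) ⟩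
  ((a ℕ.+ b) ! / (a ! ℕ.* (a ℕ.+ b ∸ a) !)) {{nonZero}} ℕ.* (a ! ℕ.* (a ℕ.+ b ∸ a) !)
    ≡⟨ m/n*n≡m {{nonZero}} (k![n∸k]!∣n! a≤a+b) ⟩
  (a ℕ.+ b) ! ∎
  where
  a≤a+b : a ≤ a ℕ.+ b
  a≤a+b = ℕP.m≤m+n a b
  nonZero : ℕ.NonZero (a ! ℕ.* (a ℕ.+ b ∸ a) !)
  nonZero = a ℕP.!* (a ℕ.+ b ∸ a) !≢0

choose-absorb : ∀ r k → (suc (r ℕ.+ k) C k) ℕ.* suc r ≡ suc (r ℕ.+ k) ℕ.* ((r ℕ.+ k) C k)
choose-absorb r k = ℕP.*-cancelʳ-≡ _ _ (k ! ℕ.* r !) {{k ℕP.!* r !≢0}} (begin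
  (suc (r ℕ.+ k) C k) ℕ.* suc r ℕ.* (k ! ℕ.* r !)
    ≡⟨ regroup (suc (r ℕ.+ k) C k) (suc r) (k !) (r !) ⟩
  (suc (r ℕ.+ k) C k) ℕ.* (k ! ℕ.* suc r !)
    ≡⟨ cong (λ m → (m C k) ℕ.* (k ! ℕ.* suc r !)) k+1+r ⟩
  ((k ℕ.+ suc r) C k) ℕ.* (k ! ℕ.* suc r !)
    ≡⟨ choose-factorial k (suc r) ⟩
  (k ℕ.+ suc r) !
    ≡⟨ cong _! (sym k+1+r) ⟩
  suc (r ℕ.+ k) ℕ.* (r ℕ.+ k) !
    ≡⟨ cong (λ m → suc (r ℕ.+ k) ℕ.* m !) (ℕP.+-comm r k) ⟩
  suc (r ℕ.+ k) ℕ.* (k ℕ.+ r) !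
    ≡⟨ cong (suc (r ℕ.+ k) ℕ.*_) (sym (choose-factorial k r)) ⟩
  suc (r ℕ.+ k) ℕ.* (((k ℕ.+ r) C k) ℕ.* (k ! ℕ.* r !))
    ≡⟨ cong (λ m → suc (r ℕ.+ k) ℕ.* ((m C k) ℕ.* (k ! ℕ.* r !))) (ℕP.+-comm k r) ⟩
  suc (r ℕ.+ k) ℕ.* (((r ℕ.+ k) C k) ℕ.* (k ! ℕ.* r !))
    ≡⟨ sym (ℕP.*-assoc (suc (r ℕ.+ k)) ((r ℕ.+ k) C k) (k ! ℕ.* r !)) ⟩
  suc (r ℕ.+ k) ℕ.* ((r ℕ.+ k) C k) ℕ.* (k ! ℕ.* r !) ∎)
  where
  regroup : ∀ c x y z → c ℕ.* x ℕ.* (y ℕ.* z) ≡ c ℕ.* (y ℕ.* (x ℕ.* z))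
  regroup = ℕ-Ring.solve-∀
  k+1+r : suc (r ℕ.+ k) ≡ k ℕ.+ suc r
  k+1+r = trans (cong suc (ℕP.+-comm r k)) (sym (ℕP.+-suc k r))

rising : ℕ → ℕ → ℕ
rising i zero    = 1
rising i (suc k) = suc i ℕ.* rising (suc i) k

rising-factorial : ∀ i k → rising i k ℕ.* i ! ≡ (i ℕ.+ k) !
rising-factorial i zero    = trans (ℕP.+-identityʳ (i !)) (cong _! (sym (ℕP.+-identityʳ i)))
rising-factorial i (suc k) = begin
  suc i ℕ.* rising (suc i) k ℕ.* i ! ≡⟨ swap (suc i) (rising (suc i) k) (i !) ⟩
  rising (suc i) k ℕ.* suc i !     ≡⟨ rising-factorial (suc i) k ⟩
  (suc i ℕ.+ k) !                 ≡⟨ cong _! (sym (ℕP.+-suc i k)) ⟩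
  (i ℕ.+ suc k) !                 ∎
  where
  swap : ∀ x y z → x ℕ.* y ℕ.* z ≡ y ℕ.* (x ℕ.* z)
  swap = ℕ-Ring.solve-∀

linear-*-zero : ∀ (q p : Poly) → q 0 ≡ 0ℚ → (q *ₚ p) 0 ≡ 0ℚ
linear-*-zero q p q₀ = trans (cong (_* p 0) q₀) (ℚP.*-zeroˡ (p 0))

linear-*-suc : ∀ (q p : Poly) c → q 0 ≡ 0ℚ → q 1 ≡ c → (∀ k → q (suc (suc k)) ≡ 0ℚ) →
               ∀ i → (q *ₚ p) (suc i) ≡ c * p i
linear-*-suc q p c q₀ q₁ q₂ i = begin
  sumTo (suc i) (λ a → q a * p (suc i ∸ a))
    ≡⟨ sumTo-truncate 1 (suc i) (s≤s z≤n) higher ⟩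
  q 0 * p (suc i) + q 1 * p i
    ≡⟨ cong₂ (λ x y → x * p (suc i) + y * p i) q₀ q₁ ⟩
  0ℚ * p (suc i) + c * p i
    ≡⟨ cong (_+ c * p i) (ℚP.*-zeroˡ (p (suc i))) ⟩
  0ℚ + c * p i
    ≡⟨ ℚP.+-identityˡ (c * p i) ⟩
  c * p i ∎
  where
  higher : ∀ k → 1 < k → k ≤ suc i → q k * p (suc i ∸ k) ≡ 0ℚ
  higher (suc zero)    (s≤s ()) _
  higher (suc (suc k)) _ _ = trans (cong (_* p (suc i ∸ suc (suc k))) (q₂ k)) (ℚP.*-zeroˡ (p (suc i ∸ suc (suc k))))

2x-*-suc : ∀ p i → ((⟦ 2 ⟧ ·ₚ X) *ₚ p) (suc i) ≡ ⟦ 2 ⟧ * p i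
2x-*-suc p i = linear-*-suc (⟦ 2 ⟧ ·ₚ X) p ⟦ 2 ⟧ refl refl (λ _ → refl) i

Q : Poly
Q = (X *ₚ X) +ₚ constP (- 1ℚ)

Q-*-0 : ∀ p → (Q *ₚ p) 0 ≡ - p 0
Q-*-0 p = trans (sym (ℚP.neg-distribˡ-* 1ℚ (p 0))) (cong -_ (ℚP.*-identityˡ (p 0)))

Q-*-1 : ∀ p → (Q *ₚ p) 1 ≡ - p 1
Q-*-1 p = trans (cong₂ _+_ (Q-*-0 (λ i → p (suc i))) (ℚP.*-zeroˡ (p 0))) (ℚP.+-identityʳ (- p 1))

Q-*-suc-suc : ∀ p i → (Q *ₚ p) (suc (suc i)) ≡ - p (suc (suc i)) + p i
Q-*-suc-suc p i = begin
  sumTo (suc (suc i)) (λ a → Q a * p (suc (suc i) ∸ a))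
    ≡⟨ sumTo-truncate 2 (suc (suc i)) (s≤s (s≤s z≤n)) higher ⟩
  (Q 0 * p (suc (suc i)) + Q 1 * p (suc i)) + Q 2 * p i
    ≡⟨ cong₂ (λ x y → (x + y) + Q 2 * p i) (Q-*-0 (λ _ → p (suc (suc i)))) (ℚP.*-zeroˡ (p (suc i))) ⟩
  (- p (suc (suc i)) + 0ℚ) + 1ℚ * p i
    ≡⟨ cong₂ _+_ (ℚP.+-identityʳ (- p (suc (suc i)))) (ℚP.*-identityˡ (p i)) ⟩
  - p (suc (suc i)) + p i ∎
  where
  Q-high : ∀ k → Q (suc (suc (suc k))) ≡ 0ℚ
  Q-high k = trans (cong (_+ 0ℚ) (linear-*-suc X X 1ℚ refl refl (λ _ → refl) (suc (suc k)))) refl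
  higher : ∀ k → 2 < k → k ≤ suc (suc i) → Q k * p (suc (suc i) ∸ k) ≡ 0ℚ
  higher (suc zero)          (s≤s ())       _
  higher (suc (suc zero))    (s≤s (s≤s ())) _
  higher (suc (suc (suc k))) _ _ = trans (cong (_* p (suc (suc i) ∸ suc (suc (suc k)))) (Q-high k)) (ℚP.*-zeroˡ (p (suc (suc i) ∸ suc (suc (suc k)))))

Q^-even : ∀ k m → (Q ^ₚ k) (0 +2× m) ≡ sgn (k ℕ.+ m) * ⟦ k C m ⟧
Q^-even zero    zero    = refl
Q^-even zero    (suc m) = sym (ℚP.*-zeroʳ (sgn (suc m)))
Q^-even (suc k) zero    = trans (Q-*-0 (Q ^ₚ k)) (trans (cong -_ (Q^-even k 0)) (ℚP.neg-distribˡ-* (sgn (k ℕ.+ 0)) 1ℚ))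
Q^-even (suc k) (suc m) = begin
  (Q ^ₚ suc k) (0 +2× suc m)
    ≡⟨ Q-*-suc-suc (Q ^ₚ k) (0 +2× m) ⟩
  - (Q ^ₚ k) (0 +2× suc m) + (Q ^ₚ k) (0 +2× m)
    ≡⟨ cong₂ (λ x y → - x + y) (Q^-even k (suc m)) (Q^-even k m) ⟩
  - (sgn (k ℕ.+ suc m) * ⟦ k C suc m ⟧) + sgn (k ℕ.+ m) * ⟦ k C m ⟧
    ≡⟨ cong (λ n → - (sgn n * ⟦ k C suc m ⟧) + sgn (k ℕ.+ m) * ⟦ k C m ⟧) (ℕP.+-suc k m) ⟩
  - (- sgn (k ℕ.+ m) * ⟦ k C suc m ⟧) + sgn (k ℕ.+ m) * ⟦ k C m ⟧
    ≡⟨ pascal-shape (sgn (k ℕ.+ m)) ⟦ k C m ⟧ ⟦ k C suc m ⟧ ⟩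
  - (- sgn (k ℕ.+ m)) * (⟦ k C m ⟧ + ⟦ k C suc m ⟧)
    ≡⟨ cong₂ _*_ (cong (λ n → - sgn n) (sym (ℕP.+-suc k m))) (sym (⟦⟧-+ (k C m) (k C suc m))) ⟩
  sgn (suc k ℕ.+ suc m) * ⟦ k C m ℕ.+ k C suc m ⟧
    ≡⟨ cong (λ c → sgn (suc k ℕ.+ suc m) * ⟦ c ⟧) (nCk+nC[k+1]≡[n+1]C[k+1] k m) ⟩
  sgn (suc k ℕ.+ suc m) * ⟦ suc k C suc m ⟧ ∎
  where
  pascal-shape : ∀ (σ a b : ℚ) → - (- σ * b) + σ * a ≡ - (- σ) * (a + b)
  pascal-shape = solve-∀ ℚ-ring

Q^-odd : ∀ k m → (Q ^ₚ k) (suc (0 +2× m)) ≡ 0ℚ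
Q^-odd zero    m       = refl
Q^-odd (suc k) zero    = trans (Q-*-1 (Q ^ₚ k)) (cong -_ (Q^-odd k 0))
Q^-odd (suc k) (suc m) = trans (Q-*-suc-suc (Q ^ₚ k) (suc (0 +2× m)))
                               (cong₂ (λ x y → - x + y) (Q^-odd k (suc m)) (Q^-odd k m))

Q^-degree : ∀ k n → k ℕ.+ k < n → (Q ^ₚ k) n ≡ 0ℚ
Q^-degree zero    (suc n)       _               = refl
Q^-degree (suc k) (suc (suc n)) (s≤s (s≤s 2k<n)) =
  trans (Q-*-suc-suc (Q ^ₚ k) n) (cong₂ (λ x y → - x + y) (Q^-degree k (suc (suc n)) (ℕP.m<n⇒m<1+n (ℕP.m<n⇒m<1+n 2k<n'))) (Q^-degree k n 2k<n'))
  where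
  2k<n' : k ℕ.+ k < n
  2k<n' = subst (_≤ n) (ℕP.+-suc k k) 2k<n

iter-D : ∀ k p i → iter k D p i ≡ ⟦ rising i k ⟧ * p (i ℕ.+ k)
iter-D zero    p i = trans (cong p (sym (ℕP.+-identityʳ i))) (sym (ℚP.*-identityˡ (p (i ℕ.+ 0))))
iter-D (suc k) p i = begin
  ⟦ suc i ⟧ * iter k D p (suc i)
    ≡⟨ cong (⟦ suc i ⟧ *_) (iter-D k p (suc i)) ⟩
  ⟦ suc i ⟧ * (⟦ rising (suc i) k ⟧ * p (suc i ℕ.+ k))
    ≡⟨ sym (ℚP.*-assoc ⟦ suc i ⟧ ⟦ rising (suc i) k ⟧ _) ⟩
  ⟦ suc i ⟧ * ⟦ rising (suc i) k ⟧ * p (suc i ℕ.+ k)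
    ≡⟨ cong₂ _*_ (sym (⟦⟧-* (suc i) (rising (suc i) k))) (cong p (sym (ℕP.+-suc i k))) ⟩
  ⟦ rising i (suc k) ⟧ * p (i ℕ.+ suc k) ∎

legendre-coeff : ∀ k i → Legendre k i ≡ frac 1 (k ! ℕ.* 2 ^ k) * (⟦ rising i k ⟧ * (Q ^ₚ k) (i ℕ.+ k))
legendre-coeff k i = cong (frac 1 (k ! ℕ.* 2 ^ k) *_) (iter-D k (Q ^ₚ k) i)

legendre-vanishes : ∀ k i → (Q ^ₚ k) (i ℕ.+ k) ≡ 0ℚ → Legendre k i ≡ 0ℚ
legendre-vanishes k i Q^k₀ = begin
  Legendre k i                                              ≡⟨ legendre-coeff k i ⟩
  frac 1 (k ! ℕ.* 2 ^ k) * (⟦ rising i k ⟧ * (Q ^ₚ k) (i ℕ.+ k)) ≡⟨ cong (λ x → frac 1 (k ! ℕ.* 2 ^ k) * (⟦ rising i k ⟧ * x)) Q^k₀ ⟩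
  frac 1 (k ! ℕ.* 2 ^ k) * (⟦ rising i k ⟧ * 0ℚ)              ≡⟨ cong (frac 1 (k ! ℕ.* 2 ^ k) *_) (ℚP.*-zeroʳ ⟦ rising i k ⟧) ⟩
  frac 1 (k ! ℕ.* 2 ^ k) * 0ℚ                                 ≡⟨ ℚP.*-zeroʳ (frac 1 (k ! ℕ.* 2 ^ k)) ⟩
  0ℚ                                                        ∎

legendre-above-degree : ∀ k i → k < i → Legendre k i ≡ 0ℚ
legendre-above-degree k i k<i = legendre-vanishes k i (Q^-degree k (i ℕ.+ k) (ℕP.+-monoˡ-< k k<i))

legendre-odd : ∀ k i m → i ℕ.+ k ≡ suc (0 +2× m) → Legendre k i ≡ 0ℚ
legendre-odd k i m i+k-odd = legendre-vanishes k i (trans (cong (Q ^ₚ k) i+k-odd) (Q^-odd k m))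

legendre-even : ∀ i t → Legendre (i +2× t) i ≡
  sgn t * (frac 1 ((i +2× t) ! ℕ.* 2 ^ (i +2× t)) * (⟦ rising i (i +2× t) ⟧ * ⟦ (i +2× t) C (i ℕ.+ t) ⟧))
legendre-even i t = begin
  Legendre k i
    ≡⟨ legendre-coeff k i ⟩
  c * (⟦ rising i k ⟧ * (Q ^ₚ k) (i ℕ.+ k))
    ≡⟨ cong (λ n → c * (⟦ rising i k ⟧ * (Q ^ₚ k) n)) i+k-even ⟩
  c * (⟦ rising i k ⟧ * (Q ^ₚ k) (0 +2× (i ℕ.+ t)))
    ≡⟨ cong (λ x → c * (⟦ rising i k ⟧ * x)) (Q^-even k (i ℕ.+ t)) ⟩
  c * (⟦ rising i k ⟧ * (sgn (k ℕ.+ (i ℕ.+ t)) * ⟦ k C (i ℕ.+ t) ⟧))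
    ≡⟨ cong (λ σ → c * (⟦ rising i k ⟧ * (σ * ⟦ k C (i ℕ.+ t) ⟧))) sign ⟩
  c * (⟦ rising i k ⟧ * (sgn t * ⟦ k C (i ℕ.+ t) ⟧))
    ≡⟨ pull-sign c ⟦ rising i k ⟧ (sgn t) ⟦ k C (i ℕ.+ t) ⟧ ⟩
  sgn t * (c * (⟦ rising i k ⟧ * ⟦ k C (i ℕ.+ t) ⟧)) ∎
  where
  k : ℕ
  k = i +2× t
  c : ℚ
  c = frac 1 (k ! ℕ.* 2 ^ k)
  i+k-even : i ℕ.+ k ≡ 0 +2× (i ℕ.+ t)
  i+k-even = trans (cong (i ℕ.+_) (+2×-spec i t)) (trans (arith i t) (sym (+2×-spec 0 (i ℕ.+ t))))
    where
    arith : ∀ i t → i ℕ.+ (i ℕ.+ (t ℕ.+ t)) ≡ 0 ℕ.+ ((i ℕ.+ t) ℕ.+ (i ℕ.+ t))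
    arith = ℕ-Ring.solve-∀
  sign : sgn (k ℕ.+ (i ℕ.+ t)) ≡ sgn t
  sign = begin
    sgn (k ℕ.+ (i ℕ.+ t))               ≡⟨ cong sgn (trans (cong (ℕ._+ (i ℕ.+ t)) (+2×-spec i t)) (arith i t)) ⟩
    sgn ((i ℕ.+ t) ℕ.+ (i ℕ.+ t) ℕ.+ t) ≡⟨ sgn-+ ((i ℕ.+ t) ℕ.+ (i ℕ.+ t)) t ⟩
    sgn ((i ℕ.+ t) ℕ.+ (i ℕ.+ t)) * sgn t ≡⟨ cong (_* sgn t) (sgn-even (i ℕ.+ t)) ⟩
    1ℚ * sgn t                          ≡⟨ ℚP.*-identityˡ (sgn t) ⟩
    sgn t                               ∎
    where
    arith : ∀ i t → i ℕ.+ (t ℕ.+ t) ℕ.+ (i ℕ.+ t) ≡ (i ℕ.+ t) ℕ.+ (i ℕ.+ t) ℕ.+ t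
    arith = ℕ-Ring.solve-∀
  pull-sign : ∀ (c r σ b : ℚ) → c * (r * (σ * b)) ≡ σ * (c * (r * b))
  pull-sign = solve-∀ ℚ-ring

-- Coefficients of the Hermite polynomials.

hermite-step : ∀ n i → Hermite (suc (suc n)) (suc i) ≡
               ⟦ 2 ⟧ * Hermite (suc n) i + (- ⟦ 2 ℕ.* suc n ⟧) * Hermite n (suc i)
hermite-step n i = cong (_+ (- ⟦ 2 ℕ.* suc n ⟧) * Hermite n (suc i)) (2x-*-suc (Hermite (suc n)) i)

hermiteNum-step : ∀ n → HermiteNum (suc (suc n)) ≡ - ⟦ 2 ℕ.* suc n ⟧ * HermiteNum n
hermiteNum-step n = trans (cong (_+ (- ⟦ 2 ℕ.* suc n ⟧) * HermiteNum n) (linear-*-zero (⟦ 2 ⟧ ·ₚ X) (Hermite (suc n)) refl))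
                          (ℚP.+-identityˡ _)

private
  zero-combination : ∀ n → ⟦ 2 ⟧ * 0ℚ + (- ⟦ 2 ℕ.* suc n ⟧) * 0ℚ ≡ 0ℚ
  zero-combination n = cong (λ x → 0ℚ + x) (ℚP.*-zeroʳ (- ⟦ 2 ℕ.* suc n ⟧))

hermite-above-degree : ∀ n i → n < i → Hermite n i ≡ 0ℚ
hermite-above-degree zero          (suc i)          _       = refl
hermite-above-degree (suc zero)    (suc zero)       (s≤s ())
hermite-above-degree (suc zero)    (suc (suc i))    _       = ℚP.*-zeroʳ ⟦ 2 ⟧
hermite-above-degree (suc (suc n)) (suc i)          (s≤s n+1<i) = begin
  Hermite (suc (suc n)) (suc i)
    ≡⟨ hermite-step n i ⟩
  ⟦ 2 ⟧ * Hermite (suc n) i + (- ⟦ 2 ℕ.* suc n ⟧) * Hermite n (suc i)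
    ≡⟨ cong₂ (λ x y → ⟦ 2 ⟧ * x + (- ⟦ 2 ℕ.* suc n ⟧) * y)
             (hermite-above-degree (suc n) i n+1<i)
             (hermite-above-degree n (suc i) (ℕP.m<n⇒m<1+n (ℕP.<-trans (ℕP.n<1+n n) n+1<i))) ⟩
  ⟦ 2 ⟧ * 0ℚ + (- ⟦ 2 ℕ.* suc n ⟧) * 0ℚ
    ≡⟨ zero-combination n ⟩
  0ℚ ∎

hermite-leading : ∀ m → Hermite m m ≡ ⟦ 2 ^ m ⟧
hermite-leading zero          = refl
hermite-leading (suc zero)    = refl
hermite-leading (suc (suc m)) = begin
  Hermite (suc (suc m)) (suc (suc m))
    ≡⟨ hermite-step m (suc m) ⟩
  ⟦ 2 ⟧ * Hermite (suc m) (suc m) + (- ⟦ 2 ℕ.* suc m ⟧) * Hermite m (suc (suc m))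
    ≡⟨ cong₂ (λ x y → ⟦ 2 ⟧ * x + (- ⟦ 2 ℕ.* suc m ⟧) * y)
             (hermite-leading (suc m)) (hermite-above-degree m (suc (suc m)) (ℕP.m<n⇒m<1+n ℕP.≤-refl)) ⟩
  ⟦ 2 ⟧ * ⟦ 2 ^ suc m ⟧ + (- ⟦ 2 ℕ.* suc m ⟧) * 0ℚ
    ≡⟨ cong (λ x → ⟦ 2 ⟧ * ⟦ 2 ^ suc m ⟧ + x) (ℚP.*-zeroʳ (- ⟦ 2 ℕ.* suc m ⟧)) ⟩
  ⟦ 2 ⟧ * ⟦ 2 ^ suc m ⟧ + 0ℚ
    ≡⟨ ℚP.+-identityʳ (⟦ 2 ⟧ * ⟦ 2 ^ suc m ⟧) ⟩
  ⟦ 2 ⟧ * ⟦ 2 ^ suc m ⟧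
    ≡⟨ sym (⟦⟧-* 2 (2 ^ suc m)) ⟩
  ⟦ 2 ^ suc (suc m) ⟧ ∎

hermite-subleading : ∀ m → Hermite (suc m) m ≡ 0ℚ
hermite-subleading zero    = refl
hermite-subleading (suc m) = begin
  Hermite (suc (suc m)) (suc m)
    ≡⟨ hermite-step m m ⟩
  ⟦ 2 ⟧ * Hermite (suc m) m + (- ⟦ 2 ℕ.* suc m ⟧) * Hermite m (suc m)
    ≡⟨ cong₂ (λ x y → ⟦ 2 ⟧ * x + (- ⟦ 2 ℕ.* suc m ⟧) * y) (hermite-subleading m) (hermite-above-degree m (suc m) ℕP.≤-refl) ⟩
  ⟦ 2 ⟧ * 0ℚ + (- ⟦ 2 ℕ.* suc m ⟧) * 0ℚ
    ≡⟨ zero-combination m ⟩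
  0ℚ ∎

hermite-coeff : ∀ r i → Hermite (r ℕ.+ i) i ≡ ⟦ ((r ℕ.+ i) C i) ℕ.* 2 ^ i ⟧ * HermiteNum r
hermite-coeff r zero rewrite ℕP.+-identityʳ r = sym (ℚP.*-identityˡ (HermiteNum r))
hermite-coeff zero (suc i) = begin
  Hermite (suc i) (suc i)                       ≡⟨ hermite-leading (suc i) ⟩
  ⟦ 2 ^ suc i ⟧                                 ≡⟨ cong ⟦_⟧ (sym (ℕP.*-identityˡ (2 ^ suc i))) ⟩
  ⟦ 1 ℕ.* 2 ^ suc i ⟧                           ≡⟨ cong (λ c → ⟦ c ℕ.* 2 ^ suc i ⟧) (sym (nCn≡1 (suc i))) ⟩
  ⟦ (suc i C suc i) ℕ.* 2 ^ suc i ⟧             ≡⟨ sym (ℚP.*-identityʳ _) ⟩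
  ⟦ (suc i C suc i) ℕ.* 2 ^ suc i ⟧ * 1ℚ         ∎
hermite-coeff (suc zero) (suc i) =
  trans (hermite-subleading (suc i)) (sym (ℚP.*-zeroʳ ⟦ (suc (suc i) C suc i) ℕ.* 2 ^ suc i ⟧))
hermite-coeff (suc (suc r)) (suc i) = begin
  Hermite (suc n) (suc i)
    ≡⟨ hermite-step (r ℕ.+ suc i) i ⟩
  two * Hermite n i + (- ⟦ 2 ℕ.* n ⟧) * Hermite (r ℕ.+ suc i) (suc i)
    ≡⟨ cong₂ (λ x y → two * x + (- ⟦ 2 ℕ.* n ⟧) * y) lower-row (hermite-coeff r (suc i)) ⟩
  two * (⟦ B₁ ℕ.* P ⟧ * HermiteNum (suc (suc r))) + (- ⟦ 2 ℕ.* n ⟧) * (⟦ B₂ ℕ.* (2 ℕ.* P) ⟧ * HermiteNum r)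
    ≡⟨ cong (λ x → two * (⟦ B₁ ℕ.* P ⟧ * x) + (- ⟦ 2 ℕ.* n ⟧) * (⟦ B₂ ℕ.* (2 ℕ.* P) ⟧ * HermiteNum r)) (hermiteNum-step r) ⟩
  two * (⟦ B₁ ℕ.* P ⟧ * (- ⟦ 2 ℕ.* suc r ⟧ * HermiteNum r)) + (- ⟦ 2 ℕ.* n ⟧) * (⟦ B₂ ℕ.* (2 ℕ.* P) ⟧ * HermiteNum r)
    ≡⟨ split-casts ⟩
  two * (b₁ * p * (- (two * ρ) * HermiteNum r)) + (- (two * ν)) * (b₂ * (two * p) * HermiteNum r)
    ≡⟨ factor b₁ b₂ p two ρ ν (HermiteNum r) ⟩
  - (two * two * p * HermiteNum r) * (b₁ * ρ + ν * b₂)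
    ≡⟨ cong (λ x → - (two * two * p * HermiteNum r) * (b₁ * ρ + x)) (sym absorb) ⟩
  - (two * two * p * HermiteNum r) * (b₁ * ρ + b₄ * ρ)
    ≡⟨ unfactor b₁ b₄ p two ρ (HermiteNum r) ⟩
  (b₁ + b₄) * (two * p) * (- (two * ρ) * HermiteNum r)
    ≡⟨ sym join-casts ⟩
  ⟦ (B₁ ℕ.+ B₄) ℕ.* (2 ℕ.* P) ⟧ * (- ⟦ 2 ℕ.* suc r ⟧ * HermiteNum r)
    ≡⟨ cong₂ (λ c x → ⟦ c ℕ.* (2 ℕ.* P) ⟧ * x) (nCk+nC[k+1]≡[n+1]C[k+1] n i) (sym (hermiteNum-step r)) ⟩
  ⟦ (suc n C suc i) ℕ.* 2 ^ suc i ⟧ * HermiteNum (suc (suc r)) ∎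
  where
  n P B₁ B₂ B₄ : ℕ
  n = suc (r ℕ.+ suc i)
  P = 2 ^ i
  B₁ = n C i
  B₂ = (r ℕ.+ suc i) C suc i
  B₄ = n C suc i
  two p ρ ν b₁ b₂ b₄ : ℚ
  two = ⟦ 2 ⟧
  p = ⟦ P ⟧
  ρ = ⟦ suc r ⟧
  ν = ⟦ n ⟧
  b₁ = ⟦ B₁ ⟧
  b₂ = ⟦ B₂ ⟧
  b₄ = ⟦ B₄ ⟧
  n≡r+2+i : n ≡ suc (suc r) ℕ.+ i
  n≡r+2+i = cong suc (ℕP.+-suc r i)
  lower-row : Hermite n i ≡ ⟦ B₁ ℕ.* P ⟧ * HermiteNum (suc (suc r))
  lower-row = begin
    Hermite n i                                                   ≡⟨ cong (λ m → Hermite m i) n≡r+2+i ⟩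
    Hermite (suc (suc r) ℕ.+ i) i                                 ≡⟨ hermite-coeff (suc (suc r)) i ⟩
    ⟦ ((suc (suc r) ℕ.+ i) C i) ℕ.* P ⟧ * HermiteNum (suc (suc r)) ≡⟨ cong (λ m → ⟦ (m C i) ℕ.* P ⟧ * HermiteNum (suc (suc r))) (sym n≡r+2+i) ⟩
    ⟦ B₁ ℕ.* P ⟧ * HermiteNum (suc (suc r))                        ∎
  absorb : b₄ * ρ ≡ ν * b₂
  absorb = trans (sym (⟦⟧-* B₄ (suc r))) (trans (cong ⟦_⟧ (choose-absorb r (suc i))) (⟦⟧-* n B₂))
  split-casts : two * (⟦ B₁ ℕ.* P ⟧ * (- ⟦ 2 ℕ.* suc r ⟧ * HermiteNum r)) + (- ⟦ 2 ℕ.* n ⟧) * (⟦ B₂ ℕ.* (2 ℕ.* P) ⟧ * HermiteNum r)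
              ≡ two * (b₁ * p * (- (two * ρ) * HermiteNum r)) + (- (two * ν)) * (b₂ * (two * p) * HermiteNum r)
  split-casts = cong₂ (λ x y → two * x + y)
    (cong₂ (λ a c → a * (- c * HermiteNum r)) (⟦⟧-* B₁ P) (⟦⟧-* 2 (suc r)))
    (cong₂ (λ c a → (- c) * (a * HermiteNum r)) (⟦⟧-* 2 n) (trans (⟦⟧-* B₂ (2 ℕ.* P)) (cong (b₂ *_) (⟦⟧-* 2 P))))
  join-casts : ⟦ (B₁ ℕ.+ B₄) ℕ.* (2 ℕ.* P) ⟧ * (- ⟦ 2 ℕ.* suc r ⟧ * HermiteNum r) ≡ (b₁ + b₄) * (two * p) * (- (two * ρ) * HermiteNum r)
  join-casts = cong₂ (λ a c → a * (- c * HermiteNum r))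
    (trans (⟦⟧-* (B₁ ℕ.+ B₄) (2 ℕ.* P)) (cong₂ _*_ (⟦⟧-+ B₁ B₄) (⟦⟧-* 2 P))) (⟦⟧-* 2 (suc r))
  factor : ∀ (b₁ b₂ p two ρ ν h : ℚ) →
           two * (b₁ * p * (- (two * ρ) * h)) + (- (two * ν)) * (b₂ * (two * p) * h) ≡ - (two * two * p * h) * (b₁ * ρ + ν * b₂)
  factor = solve-∀ ℚ-ring
  unfactor : ∀ (b₁ b₄ p two ρ h : ℚ) → - (two * two * p * h) * (b₁ * ρ + b₄ * ρ) ≡ (b₁ + b₄) * (two * p) * (- (two * ρ) * h)
  unfactor = solve-∀ ℚ-ring

-- Monomials in the Legendre basis: x^j = Σ_k W_k g(j,k) P_k.

weight : ℕ → ℚ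
weight k = ⟦ 2 ^ (k ℕ.+ 2) ℕ.* k ℕ.+ 2 ^ (k ℕ.+ 1) ⟧

monomialCoeff : ℕ → ℕ → ℚ
monomialCoeff j k =
  if j <ᵇ k then 0ℚ
  else if ((j ∸ k) % 2) ≡ᵇ 0 then frac ((j !) ℕ.* (((j ℕ.+ k ℕ.+ 2) / 2) !)) (((j ℕ.+ k ℕ.+ 2) !) ℕ.* (((j ∸ k) / 2) !))
  else 0ℚ

monomialTerm : ℕ → ℕ → ℕ → ℚ
monomialTerm j i k = weight k * monomialCoeff j k * Legendre k i

private
  <ᵇ-true : ∀ {m n} → m < n → (m <ᵇ n) ≡ true
  <ᵇ-true {zero}  {suc n} _           = refl
  <ᵇ-true {suc m} {suc n} (s≤s m<n) = <ᵇ-true m<n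

  <ᵇ-false : ∀ {m n} → n ≤ m → (m <ᵇ n) ≡ false
  <ᵇ-false {m}     {zero}  _         = refl
  <ᵇ-false {suc m} {suc n} (s≤s n≤m) = <ᵇ-false n≤m

  double : ∀ d → 0 +2× d ≡ d ℕ.* 2
  double d = trans (+2×-spec 0 d) (ℕ-Ring.solve (d ∷ []))

  even-mod : ∀ d → (0 +2× d) % 2 ≡ 0
  even-mod d = trans (cong (_% 2) (double d)) (m*n%n≡0 d 2)

  even-half : ∀ d → (0 +2× d) / 2 ≡ d
  even-half d = trans (cong (_/ 2) (double d)) (m*n/n≡m d 2)

  odd-mod : ∀ d → suc (0 +2× d) % 2 ≡ 1
  odd-mod d = trans (cong (λ n → suc n % 2) (double d)) ([m+kn]%n≡m%n 1 d 2)

  +2×-∸ : ∀ k d → k +2× d ∸ k ≡ 0 +2× d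
  +2×-∸ k d = trans (cong (_∸ k) (+2×-spec k d)) (trans (ℕP.m+n∸m≡n k (d ℕ.+ d)) (sym (+2×-spec 0 d)))

  k≤k+2×d : ∀ k d → k ≤ k +2× d
  k≤k+2×d k d = subst (k ≤_) (sym (+2×-spec k d)) (ℕP.m≤m+n k (d ℕ.+ d))

monomialCoeff-even : ∀ k d → monomialCoeff (k +2× d) k ≡
  frac ((k +2× d) ! ℕ.* suc (k ℕ.+ d) !) ((k +2× d ℕ.+ k ℕ.+ 2) ! ℕ.* d !)
monomialCoeff-even k d rewrite <ᵇ-false (k≤k+2×d k d) | +2×-∸ k d | even-mod d =
  cong₂ (λ a b → frac ((k +2× d) ! ℕ.* a !) ((k +2× d ℕ.+ k ℕ.+ 2) ! ℕ.* b !)) half-sum (even-half d)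
  where
  half-sum : (k +2× d ℕ.+ k ℕ.+ 2) / 2 ≡ suc (k ℕ.+ d)
  half-sum = trans (cong (_/ 2) (trans (cong (λ j → j ℕ.+ k ℕ.+ 2) (+2×-spec k d)) twice))
                   (m*n/n≡m (suc (k ℕ.+ d)) 2)
    where
    twice : k ℕ.+ (d ℕ.+ d) ℕ.+ k ℕ.+ 2 ≡ suc (k ℕ.+ d) ℕ.* 2
    twice = ℕ-Ring.solve (k ∷ d ∷ [])

monomialCoeff-odd : ∀ k d → monomialCoeff (suc (k +2× d)) k ≡ 0ℚ
monomialCoeff-odd k d rewrite <ᵇ-false (ℕP.m≤n⇒m≤1+n (k≤k+2×d k d)) | ℕP.+-∸-assoc 1 (k≤k+2×d k d) | +2×-∸ k d | odd-mod d = refl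

monomialCoeff-below : ∀ j k → j < k → monomialCoeff j k ≡ 0ℚ
monomialCoeff-below j k j<k rewrite <ᵇ-true j<k = refl

-- Fix i and write k = i + 2t, j = i + 2s with s = t + d.  The terms of the
-- expansion that contribute to x^i are (-1)^t evenTerm i t d, where
--   evenTerm = 2(2k+1) j! (k+d+1)! (i+k)! / ((j+k+2)! d! i! (i+t)! t!),
-- and its factorials are named as follows.
[2k+1] : ℕ → ℕ → ℕ
[2k+1] i t = suc ((i ℕ.+ t ℕ.+ t) ℕ.+ (i ℕ.+ t ℕ.+ t))

[j]! : ℕ → ℕ → ℕ
[j]! i s = (i ℕ.+ (s ℕ.+ s)) !

[k+d+1]! : ℕ → ℕ → ℕ → ℕ
[k+d+1]! i s t = suc (i ℕ.+ s ℕ.+ t) !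

[i+k]! : ℕ → ℕ → ℕ
[i+k]! i t = ((i ℕ.+ t) ℕ.+ (i ℕ.+ t)) !

[j+k+2]! : ℕ → ℕ → ℕ → ℕ
[j+k+2]! i s t = suc (suc ((i ℕ.+ s ℕ.+ t) ℕ.+ (i ℕ.+ s ℕ.+ t))) !

-- evenTerm′ keeps s as a separate argument, so that the step t ↦ t+1 with
-- s fixed (d ↦ d-1) does not require rewriting t + d.
evenTerm′ : (i t s d : ℕ) → ℚ
evenTerm′ i t s d = frac (2 ℕ.* [2k+1] i t ℕ.* [j]! i s ℕ.* [k+d+1]! i s t ℕ.* [i+k]! i t)
                         ([j+k+2]! i s t ℕ.* d ! ℕ.* i ! ℕ.* (i ℕ.+ t) ! ℕ.* t !)

evenTerm : (i t d : ℕ) → ℚ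
evenTerm i t d = evenTerm′ i t (t ℕ.+ d) d

-- The telescoping partial sums: Σ_{u≤t} (-1)^u evenTerm i u (s-u) = (-1)^t partialTerm i t (s-t)
-- for s ≥ 1; partialTerm = evenTerm · d(2i+2t+1) / (s(2k+1)).
partialTerm′ : (i t s d : ℕ) → ℚ
partialTerm′ i t s d = frac (2 ℕ.* d ℕ.* suc ((i ℕ.+ t) ℕ.+ (i ℕ.+ t)) ℕ.* [j]! i s ℕ.* [k+d+1]! i s t ℕ.* [i+k]! i t)
                            (s ℕ.* [j+k+2]! i s t ℕ.* d ! ℕ.* (i ℕ.+ t) ! ℕ.* t ! ℕ.* i !)

partialTerm : (i t d : ℕ) → ℚ
partialTerm i t d = partialTerm′ i t (t ℕ.+ d) d

-- Clearing the denominators of W_k g(j,k) [x^i]P_k: with W_k = 2^k·2(2k+1),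
-- (i+1)⋯(i+k) · i! = (i+k)! and (k choose i+t)(i+t)! t! = k!.
private
  evenTerm-cross : ∀ W P q J U R B G D I A T F K → W ≡ P ℕ.* (2 ℕ.* q) → R ℕ.* I ≡ F → B ℕ.* (A ℕ.* T) ≡ K →
    W ℕ.* (J ℕ.* U) ℕ.* 1 ℕ.* (R ℕ.* B) ℕ.* (G ℕ.* D ℕ.* I ℕ.* A ℕ.* T)
      ≡ 2 ℕ.* q ℕ.* J ℕ.* U ℕ.* F ℕ.* (1 ℕ.* (G ℕ.* D) ℕ.* (K ℕ.* P) ℕ.* 1)
  evenTerm-cross _ P q J U R B G D I A T F K refl R·I≡F B·A·T≡K = begin
    P ℕ.* (2 ℕ.* q) ℕ.* (J ℕ.* U) ℕ.* 1 ℕ.* (R ℕ.* B) ℕ.* (G ℕ.* D ℕ.* I ℕ.* A ℕ.* T)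
      ≡⟨ ℕ-Ring.solve (P ∷ q ∷ J ∷ U ∷ R ∷ B ∷ G ∷ D ∷ I ∷ A ∷ T ∷ []) ⟩
    2 ℕ.* q ℕ.* J ℕ.* U ℕ.* G ℕ.* D ℕ.* P ℕ.* (R ℕ.* I) ℕ.* (B ℕ.* (A ℕ.* T))
      ≡⟨ cong₂ (λ f k → 2 ℕ.* q ℕ.* J ℕ.* U ℕ.* G ℕ.* D ℕ.* P ℕ.* f ℕ.* k) R·I≡F B·A·T≡K ⟩
    2 ℕ.* q ℕ.* J ℕ.* U ℕ.* G ℕ.* D ℕ.* P ℕ.* F ℕ.* K
      ≡⟨ ℕ-Ring.solve (P ∷ q ∷ J ∷ U ∷ G ∷ D ∷ F ∷ K ∷ []) ⟩
    2 ℕ.* q ℕ.* J ℕ.* U ℕ.* F ℕ.* (1 ℕ.* (G ℕ.* D) ℕ.* (K ℕ.* P) ℕ.* 1) ∎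

monomialTerm-even : ∀ i t d → monomialTerm ((i +2× t) +2× d) i (i +2× t) ≡ sgn t * evenTerm i t d
monomialTerm-even i t d = begin
  weight k * monomialCoeff (k +2× d) k * Legendre k i
    ≡⟨ cong₂ (λ g ℓ → weight k * g * ℓ) (monomialCoeff-even k d) (legendre-even i t) ⟩
  ⟦ W ⟧ * frac (J ℕ.* U) (G ℕ.* d !) * (sgn t * (frac 1 (K ℕ.* P) * (⟦ R ⟧ * ⟦ B ⟧)))
    ≡⟨ pull-sign ⟦ W ⟧ (frac (J ℕ.* U) (G ℕ.* d !)) (sgn t) (frac 1 (K ℕ.* P)) ⟦ R ⟧ ⟦ B ⟧ ⟩
  sgn t * (⟦ W ⟧ * frac (J ℕ.* U) (G ℕ.* d !) * frac 1 (K ℕ.* P) * (⟦ R ⟧ * ⟦ B ⟧))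
    ≡⟨ cong (sgn t *_) multiply ⟩
  sgn t * frac (W ℕ.* (J ℕ.* U) ℕ.* 1 ℕ.* (R ℕ.* B)) (1 ℕ.* (G ℕ.* d !) ℕ.* (K ℕ.* P) ℕ.* 1)
    ≡⟨ cong (sgn t *_) (frac-cross {c = 2 ℕ.* [2k+1] i t ℕ.* J ℕ.* U ℕ.* [i+k]! i t}
         (suc-pos 0 ⊛ (!-pos j+k+2 ⊛ !-pos d) ⊛ (!-pos k ⊛ ℕP.m^n>0 2 k) ⊛ suc-pos 0)
         (!-pos j+k+2 ⊛ !-pos d ⊛ !-pos i ⊛ !-pos (i ℕ.+ t) ⊛ !-pos t)
         (evenTerm-cross W P ([2k+1] i t) J U R B G (d !) (i !) ((i ℕ.+ t) !) (t !) ([i+k]! i t) K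
                         weight-split rising-cancel choose-cancel)) ⟩
  sgn t * frac (2 ℕ.* [2k+1] i t ℕ.* J ℕ.* U ℕ.* [i+k]! i t) (G ℕ.* d ! ℕ.* i ! ℕ.* (i ℕ.+ t) ! ℕ.* t !)
    ≡⟨ cong₂ (λ x y → sgn t * frac x y)
         (cong₂ (λ a b → 2 ℕ.* [2k+1] i t ℕ.* a ! ℕ.* b ! ℕ.* [i+k]! i t) j≡ k+d+1≡)
         (cong (λ c → c ! ℕ.* d ! ℕ.* i ! ℕ.* (i ℕ.+ t) ! ℕ.* t !) j+k+2≡) ⟩
  sgn t * evenTerm i t d ∎
  where
  k W J U j+k+2 G K P R B : ℕ
  k = i +2× t
  W = 2 ^ (k ℕ.+ 2) ℕ.* k ℕ.+ 2 ^ (k ℕ.+ 1)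
  J = (k +2× d) !
  U = suc (k ℕ.+ d) !
  j+k+2 = k +2× d ℕ.+ k ℕ.+ 2
  G = j+k+2 !
  K = k !
  P = 2 ^ k
  R = rising i k
  B = k C (i ℕ.+ t)
  k≡ : k ≡ i ℕ.+ t ℕ.+ t
  k≡ = trans (+2×-spec i t) (sym (ℕP.+-assoc i t t))
  j≡ : k +2× d ≡ i ℕ.+ ((t ℕ.+ d) ℕ.+ (t ℕ.+ d))
  j≡ = trans (+2×-spec k d) (trans (cong (ℕ._+ (d ℕ.+ d)) k≡) (ℕ-Ring.solve (i ∷ t ∷ d ∷ [])))
  k+d+1≡ : suc (k ℕ.+ d) ≡ suc (i ℕ.+ (t ℕ.+ d) ℕ.+ t)
  k+d+1≡ = cong suc (trans (cong (ℕ._+ d) k≡) (ℕ-Ring.solve (i ∷ t ∷ d ∷ [])))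
  j+k+2≡ : k +2× d ℕ.+ k ℕ.+ 2 ≡ suc (suc ((i ℕ.+ (t ℕ.+ d) ℕ.+ t) ℕ.+ (i ℕ.+ (t ℕ.+ d) ℕ.+ t)))
  j+k+2≡ = trans (cong₂ (λ a b → a ℕ.+ b ℕ.+ 2) (+2×-spec k d) k≡)
                 (trans (cong (λ a → a ℕ.+ (d ℕ.+ d) ℕ.+ (i ℕ.+ t ℕ.+ t) ℕ.+ 2) k≡) (ℕ-Ring.solve (i ∷ t ∷ d ∷ [])))
  weight-split : W ≡ P ℕ.* (2 ℕ.* [2k+1] i t)
  weight-split = begin
    2 ^ (k ℕ.+ 2) ℕ.* k ℕ.+ 2 ^ (k ℕ.+ 1)
      ≡⟨ cong₂ (λ a b → a ℕ.* k ℕ.+ b) (ℕP.^-distribˡ-+-* 2 k 2) (ℕP.^-distribˡ-+-* 2 k 1) ⟩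
    P ℕ.* 4 ℕ.* k ℕ.+ P ℕ.* 2
      ≡⟨ factor P k ⟩
    P ℕ.* (2 ℕ.* suc (k ℕ.+ k))
      ≡⟨ cong (λ m → P ℕ.* (2 ℕ.* suc (m ℕ.+ m))) k≡ ⟩
    P ℕ.* (2 ℕ.* [2k+1] i t) ∎
    where
    factor : ∀ P k → P ℕ.* 4 ℕ.* k ℕ.+ P ℕ.* 2 ≡ P ℕ.* (2 ℕ.* suc (k ℕ.+ k))
    factor = ℕ-Ring.solve-∀
  rising-cancel : R ℕ.* i ! ≡ [i+k]! i t
  rising-cancel = trans (rising-factorial i k) (cong _! (trans (cong (i ℕ.+_) k≡) i+k≡))
    where
    i+k≡ : i ℕ.+ (i ℕ.+ t ℕ.+ t) ≡ (i ℕ.+ t) ℕ.+ (i ℕ.+ t)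
    i+k≡ = ℕ-Ring.solve (i ∷ t ∷ [])
  choose-cancel : B ℕ.* ((i ℕ.+ t) ! ℕ.* t !) ≡ K
  choose-cancel = begin
    (k C (i ℕ.+ t)) ℕ.* ((i ℕ.+ t) ! ℕ.* t !)                 ≡⟨ cong (λ m → (m C (i ℕ.+ t)) ℕ.* ((i ℕ.+ t) ! ℕ.* t !)) k≡ ⟩
    ((i ℕ.+ t ℕ.+ t) C (i ℕ.+ t)) ℕ.* ((i ℕ.+ t) ! ℕ.* t !)   ≡⟨ choose-factorial (i ℕ.+ t) t ⟩
    (i ℕ.+ t ℕ.+ t) !                                       ≡⟨ cong _! (sym k≡) ⟩
    K                                                       ∎
  pull-sign : ∀ (w g σ c r b : ℚ) → w * g * (σ * (c * (r * b))) ≡ σ * (w * g * c * (r * b))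
  pull-sign = solve-∀ ℚ-ring
  multiply : ⟦ W ⟧ * frac (J ℕ.* U) (G ℕ.* d !) * frac 1 (K ℕ.* P) * (⟦ R ⟧ * ⟦ B ⟧)
             ≡ frac (W ℕ.* (J ℕ.* U) ℕ.* 1 ℕ.* (R ℕ.* B)) (1 ℕ.* (G ℕ.* d !) ℕ.* (K ℕ.* P) ℕ.* 1)
  multiply = begin
    ⟦ W ⟧ * frac (J ℕ.* U) (G ℕ.* d !) * frac 1 (K ℕ.* P) * (⟦ R ⟧ * ⟦ B ⟧)
      ≡⟨ cong₂ (λ x y → x * frac 1 (K ℕ.* P) * y) (frac-* W 1 (J ℕ.* U) (G ℕ.* d !)) (frac-* R 1 B 1) ⟩
    frac (W ℕ.* (J ℕ.* U)) (1 ℕ.* (G ℕ.* d !)) * frac 1 (K ℕ.* P) * frac (R ℕ.* B) 1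
      ≡⟨ cong (_* frac (R ℕ.* B) 1) (frac-* (W ℕ.* (J ℕ.* U)) (1 ℕ.* (G ℕ.* d !)) 1 (K ℕ.* P)) ⟩
    frac (W ℕ.* (J ℕ.* U) ℕ.* 1) (1 ℕ.* (G ℕ.* d !) ℕ.* (K ℕ.* P)) * frac (R ℕ.* B) 1
      ≡⟨ frac-* (W ℕ.* (J ℕ.* U) ℕ.* 1) (1 ℕ.* (G ℕ.* d !) ℕ.* (K ℕ.* P)) (R ℕ.* B) 1 ⟩
    frac (W ℕ.* (J ℕ.* U) ℕ.* 1 ℕ.* (R ℕ.* B)) (1 ℕ.* (G ℕ.* d !) ℕ.* (K ℕ.* P) ℕ.* 1) ∎

-- The two boundary values: evenTerm i 0 0 = 1 (it is the whole sum for
-- j = i), and partialTerm i t 0 = 0 (the sum vanishes for j > i).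
evenTerm-origin : ∀ i → evenTerm i 0 0 ≡ 1ℚ
evenTerm-origin i = frac-cross {c = 1} (!-pos (suc (suc ((i ℕ.+ 0 ℕ.+ 0) ℕ.+ (i ℕ.+ 0 ℕ.+ 0)))) ⊛ !-pos 0 ⊛ !-pos i ⊛ !-pos (i ℕ.+ 0) ⊛ !-pos 0)
                               (suc-pos 0) cross
  where
  identity : ∀ i A B → 2 ℕ.* suc (i ℕ.+ i) ℕ.* A ℕ.* (suc i ℕ.* A) ℕ.* B ℕ.* 1
                       ≡ 1 ℕ.* (suc (suc (i ℕ.+ i)) ℕ.* (suc (i ℕ.+ i) ℕ.* B) ℕ.* 1 ℕ.* A ℕ.* A ℕ.* 1)
  identity = ℕ-Ring.solve-∀
  cross : 2 ℕ.* [2k+1] i 0 ℕ.* [j]! i 0 ℕ.* [k+d+1]! i 0 0 ℕ.* [i+k]! i 0 ℕ.* 1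
          ≡ 1 ℕ.* ([j+k+2]! i 0 0 ℕ.* 0 ! ℕ.* i ! ℕ.* (i ℕ.+ 0) ! ℕ.* 0 !)
  cross rewrite ℕP.+-identityʳ i | ℕP.+-identityʳ i = identity i (i !) ((i ℕ.+ i) !)

partialTerm-end : ∀ i t → partialTerm i t 0 ≡ 0ℚ
partialTerm-end i t = frac-zero ((t ℕ.+ 0) ℕ.* [j+k+2]! i (t ℕ.+ 0) t ℕ.* 0 ! ℕ.* (i ℕ.+ t) ! ℕ.* t ! ℕ.* i !)

evenTerm-first : ∀ i d → evenTerm i 0 (suc d) ≡ partialTerm i 0 (suc d)
evenTerm-first i d = begin
  frac (2 ℕ.* [2k+1] i 0 ℕ.* J ℕ.* U ℕ.* B) D₁
    ≡⟨ cong (λ m → frac (2 ℕ.* suc (m ℕ.+ m) ℕ.* J ℕ.* U ℕ.* B) D₁) (ℕP.+-identityʳ (i ℕ.+ 0)) ⟩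
  frac (2 ℕ.* q ℕ.* J ℕ.* U ℕ.* B) D₁
    ≡⟨ frac-cross (!-pos g ⊛ !-pos (suc d) ⊛ !-pos i ⊛ !-pos (i ℕ.+ 0) ⊛ !-pos 0)
                  (suc-pos d ⊛ !-pos g ⊛ !-pos (suc d) ⊛ !-pos (i ℕ.+ 0) ⊛ !-pos 0 ⊛ !-pos i)
                  (identity q (suc d) J U B G (suc d !) ((i ℕ.+ 0) !) (0 !) (i !)) ⟩
  frac (2 ℕ.* suc d ℕ.* q ℕ.* J ℕ.* U ℕ.* B) D₂ ∎
  where
  J U B g G q D₁ D₂ : ℕ
  J = [j]! i (suc d)
  U = [k+d+1]! i (suc d) 0
  B = [i+k]! i 0
  g = suc (suc ((i ℕ.+ suc d ℕ.+ 0) ℕ.+ (i ℕ.+ suc d ℕ.+ 0)))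
  G = g !
  q = suc ((i ℕ.+ 0) ℕ.+ (i ℕ.+ 0))
  D₁ = G ℕ.* suc d ! ℕ.* i ! ℕ.* (i ℕ.+ 0) ! ℕ.* 0 !
  D₂ = suc d ℕ.* G ℕ.* suc d ! ℕ.* (i ℕ.+ 0) ! ℕ.* 0 ! ℕ.* i !
  identity : ∀ q s J U B G D A Z I → 2 ℕ.* q ℕ.* J ℕ.* U ℕ.* B ℕ.* (s ℕ.* G ℕ.* D ℕ.* A ℕ.* Z ℕ.* I)
                                     ≡ 2 ℕ.* s ℕ.* q ℕ.* J ℕ.* U ℕ.* B ℕ.* (G ℕ.* D ℕ.* I ℕ.* A ℕ.* Z)
  identity = ℕ-Ring.solve-∀

-- With k = i+2t and s = t+d+1, all three terms are brought to the form Num·x/(Den·y) with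
--   Num = 2(2i+2t+1) j! (k+d+1)! (i+k)!   and   Den = (j+k+2)! d! (i+t)! t! i!,
-- after which the step is the identity (2i+2s+2t+3)(t+1) + d(2i+2t+3) = (2i+4t+5) s.
module _ (i t d : ℕ) where
  private
    s a M v u M₃ M₄ A₂ J U B G Num Den : ℕ
    s  = suc (t ℕ.+ d)
    a  = i ℕ.+ t
    M  = i ℕ.+ s ℕ.+ t
    v  = suc (a ℕ.+ a)
    u  = suc (suc (suc (a ℕ.+ a)))
    M₃ = suc (suc (suc (M ℕ.+ M)))
    M₄ = suc (suc (suc (suc (M ℕ.+ M))))
    A₂ = suc (suc (a ℕ.+ a))
    J  = [j]! i s
    U  = [k+d+1]! i s t
    B  = [i+k]! i t
    G  = [j+k+2]! i s t
    Num  = 2 ℕ.* v ℕ.* J ℕ.* U ℕ.* B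
    Den  = G ℕ.* d ! ℕ.* a ! ℕ.* t ! ℕ.* i !
    Den>0 : 0 < Den
    Den>0 = !-pos (suc (suc (M ℕ.+ M))) ⊛ !-pos d ⊛ !-pos a ⊛ !-pos t ⊛ !-pos i
    i+[t+1]≡ : i ℕ.+ suc t ≡ suc a
    i+[t+1]≡ = ℕP.+-suc i t
    2[i+t+1]≡ : (i ℕ.+ suc t) ℕ.+ (i ℕ.+ suc t) ≡ suc (suc (a ℕ.+ a))
    2[i+t+1]≡ = trans (cong (λ x → x ℕ.+ x) i+[t+1]≡) (cong suc (ℕP.+-suc a a))
    M[t+1]≡ : i ℕ.+ s ℕ.+ suc t ≡ suc M
    M[t+1]≡ = ℕP.+-suc (i ℕ.+ s) t
    U[t+1]≡ : [k+d+1]! i s (suc t) ≡ suc (suc M) ℕ.* U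
    U[t+1]≡ = cong (λ x → suc x !) M[t+1]≡
    B[t+1]≡ : [i+k]! i (suc t) ≡ A₂ ℕ.* (v ℕ.* B)
    B[t+1]≡ = cong _! 2[i+t+1]≡
    G[t+1]≡ : [j+k+2]! i s (suc t) ≡ M₄ ℕ.* (M₃ ℕ.* G)
    G[t+1]≡ = cong _! (trans (cong (λ x → suc (suc (x ℕ.+ x))) M[t+1]≡) (cong (λ x → suc (suc (suc x))) (ℕP.+-suc M M)))
    a+1!≡ : (i ℕ.+ suc t) ! ≡ suc a ℕ.* a !
    a+1!≡ = cong _! i+[t+1]≡
    A₂≡ : A₂ ≡ 2 ℕ.* suc a
    A₂≡ = even-suc a
      where
      even-suc : ∀ x → suc (suc (x ℕ.+ x)) ≡ 2 ℕ.* suc x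
      even-suc = ℕ-Ring.solve-∀
    M₄≡ : M₄ ≡ 2 ℕ.* suc (suc M)
    M₄≡ = even-suc-suc M
      where
      even-suc-suc : ∀ x → suc (suc (suc (suc (x ℕ.+ x)))) ≡ 2 ℕ.* suc (suc x)
      even-suc-suc = ℕ-Ring.solve-∀

  partialTerm-left : partialTerm i t (suc d) ≡ frac (Num ℕ.* 1) (Den ℕ.* s)
  partialTerm-left = trans (cong (λ x → partialTerm′ i t x (suc d)) (ℕP.+-suc t d))
    (frac-cross (suc-pos (t ℕ.+ d) ⊛ !-pos (suc (suc (M ℕ.+ M))) ⊛ !-pos (suc d) ⊛ !-pos a ⊛ !-pos t ⊛ !-pos i)
                (Den>0 ⊛ suc-pos (t ℕ.+ d))
                (identity (suc d) v J U B G (d !) (a !) (t !) (i !) s))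
    where
    identity : ∀ d′ v J U B G Dd A T I s →
      2 ℕ.* d′ ℕ.* v ℕ.* J ℕ.* U ℕ.* B ℕ.* (G ℕ.* Dd ℕ.* A ℕ.* T ℕ.* I ℕ.* s)
        ≡ 2 ℕ.* v ℕ.* J ℕ.* U ℕ.* B ℕ.* 1 ℕ.* (s ℕ.* G ℕ.* (d′ ℕ.* Dd) ℕ.* A ℕ.* T ℕ.* I)
    identity = ℕ-Ring.solve-∀

  partialTerm-right : partialTerm i (suc t) d ≡ frac (Num ℕ.* (d ℕ.* u)) (Den ℕ.* (s ℕ.* M₃ ℕ.* suc t))
  partialTerm-right = begin
    frac (2 ℕ.* d ℕ.* suc ((i ℕ.+ suc t) ℕ.+ (i ℕ.+ suc t)) ℕ.* J ℕ.* [k+d+1]! i s (suc t) ℕ.* [i+k]! i (suc t))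
         (s ℕ.* [j+k+2]! i s (suc t) ℕ.* d ! ℕ.* (i ℕ.+ suc t) ! ℕ.* suc t ! ℕ.* i !)
      ≡⟨ cong₂ frac
           (trans (cong (λ q → 2 ℕ.* d ℕ.* q ℕ.* J ℕ.* [k+d+1]! i s (suc t) ℕ.* [i+k]! i (suc t)) (cong suc 2[i+t+1]≡))
                  (cong₂ (λ x b → 2 ℕ.* d ℕ.* u ℕ.* J ℕ.* x ℕ.* b) U[t+1]≡ B[t+1]≡))
           (cong₂ (λ g f → s ℕ.* g ℕ.* d ! ℕ.* f ℕ.* suc t ! ℕ.* i !) G[t+1]≡ a+1!≡) ⟩
    frac (2 ℕ.* d ℕ.* u ℕ.* J ℕ.* (suc (suc M) ℕ.* U) ℕ.* (A₂ ℕ.* (v ℕ.* B)))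
         (s ℕ.* (M₄ ℕ.* (M₃ ℕ.* G)) ℕ.* d ! ℕ.* (suc a ℕ.* a !) ℕ.* (suc t ℕ.* t !) ℕ.* i !)
      ≡⟨ frac-cross (suc-pos (t ℕ.+ d) ⊛ (suc-pos M₃ ⊛ (suc-pos (suc (suc (M ℕ.+ M))) ⊛ !-pos (suc (suc (M ℕ.+ M))))) ⊛ !-pos d
                       ⊛ (suc-pos a ⊛ !-pos a) ⊛ (suc-pos t ⊛ !-pos t) ⊛ !-pos i)
                    (Den>0 ⊛ (suc-pos (t ℕ.+ d) ⊛ suc-pos (suc (suc (M ℕ.+ M))) ⊛ suc-pos t))
                    (identity d u v (suc a) (suc (suc M)) M₃ J U B G (d !) (a !) (t !) (i !) s (suc t) A₂ M₄ A₂≡ M₄≡) ⟩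
    frac (Num ℕ.* (d ℕ.* u)) (Den ℕ.* (s ℕ.* M₃ ℕ.* suc t)) ∎
    where
    identity : ∀ d u v a′ M₂ M₃ J U B G Dd A T I s t′ A₂ M₄ → A₂ ≡ 2 ℕ.* a′ → M₄ ≡ 2 ℕ.* M₂ →
      2 ℕ.* d ℕ.* u ℕ.* J ℕ.* (M₂ ℕ.* U) ℕ.* (A₂ ℕ.* (v ℕ.* B)) ℕ.* (G ℕ.* Dd ℕ.* A ℕ.* T ℕ.* I ℕ.* (s ℕ.* M₃ ℕ.* t′))
        ≡ 2 ℕ.* v ℕ.* J ℕ.* U ℕ.* B ℕ.* (d ℕ.* u) ℕ.* (s ℕ.* (M₄ ℕ.* (M₃ ℕ.* G)) ℕ.* Dd ℕ.* (a′ ℕ.* A) ℕ.* (t′ ℕ.* T) ℕ.* I)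
    identity d u v a′ M₂ M₃ J U B G Dd A T I s t′ _ _ refl refl = solve d u v a′ M₂ M₃ J U B G Dd A T I s t′
      where
      solve : ∀ d u v a′ M₂ M₃ J U B G Dd A T I s t′ →
        2 ℕ.* d ℕ.* u ℕ.* J ℕ.* (M₂ ℕ.* U) ℕ.* (2 ℕ.* a′ ℕ.* (v ℕ.* B)) ℕ.* (G ℕ.* Dd ℕ.* A ℕ.* T ℕ.* I ℕ.* (s ℕ.* M₃ ℕ.* t′))
          ≡ 2 ℕ.* v ℕ.* J ℕ.* U ℕ.* B ℕ.* (d ℕ.* u) ℕ.* (s ℕ.* (2 ℕ.* M₂ ℕ.* (M₃ ℕ.* G)) ℕ.* Dd ℕ.* (a′ ℕ.* A) ℕ.* (t′ ℕ.* T) ℕ.* I)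
      solve = ℕ-Ring.solve-∀

  evenTerm-next : evenTerm i (suc t) d ≡ frac (Num ℕ.* [2k+1] i (suc t)) (Den ℕ.* (M₃ ℕ.* suc t))
  evenTerm-next = begin
    frac (2 ℕ.* q ℕ.* J ℕ.* [k+d+1]! i s (suc t) ℕ.* [i+k]! i (suc t))
         ([j+k+2]! i s (suc t) ℕ.* d ! ℕ.* i ! ℕ.* (i ℕ.+ suc t) ! ℕ.* suc t !)
      ≡⟨ cong₂ frac (cong₂ (λ x b → 2 ℕ.* q ℕ.* J ℕ.* x ℕ.* b) U[t+1]≡ B[t+1]≡)
                    (cong₂ (λ g f → g ℕ.* d ! ℕ.* i ! ℕ.* f ℕ.* suc t !) G[t+1]≡ a+1!≡) ⟩
    frac (2 ℕ.* q ℕ.* J ℕ.* (suc (suc M) ℕ.* U) ℕ.* (A₂ ℕ.* (v ℕ.* B)))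
         (M₄ ℕ.* (M₃ ℕ.* G) ℕ.* d ! ℕ.* i ! ℕ.* (suc a ℕ.* a !) ℕ.* (suc t ℕ.* t !))
      ≡⟨ frac-cross (suc-pos M₃ ⊛ (suc-pos (suc (suc (M ℕ.+ M))) ⊛ !-pos (suc (suc (M ℕ.+ M)))) ⊛ !-pos d ⊛ !-pos i
                       ⊛ (suc-pos a ⊛ !-pos a) ⊛ (suc-pos t ⊛ !-pos t))
                    (Den>0 ⊛ (suc-pos (suc (suc (M ℕ.+ M))) ⊛ suc-pos t))
                    (identity q v (suc a) (suc (suc M)) M₃ J U B G (d !) (a !) (t !) (i !) (suc t) A₂ M₄ A₂≡ M₄≡) ⟩
    frac (Num ℕ.* q) (Den ℕ.* (M₃ ℕ.* suc t)) ∎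
    where
    q = [2k+1] i (suc t)
    identity : ∀ q v a′ M₂ M₃ J U B G Dd A T I t′ A₂ M₄ → A₂ ≡ 2 ℕ.* a′ → M₄ ≡ 2 ℕ.* M₂ →
      2 ℕ.* q ℕ.* J ℕ.* (M₂ ℕ.* U) ℕ.* (A₂ ℕ.* (v ℕ.* B)) ℕ.* (G ℕ.* Dd ℕ.* A ℕ.* T ℕ.* I ℕ.* (M₃ ℕ.* t′))
        ≡ 2 ℕ.* v ℕ.* J ℕ.* U ℕ.* B ℕ.* q ℕ.* (M₄ ℕ.* (M₃ ℕ.* G) ℕ.* Dd ℕ.* I ℕ.* (a′ ℕ.* A) ℕ.* (t′ ℕ.* T))
    identity q v a′ M₂ M₃ J U B G Dd A T I t′ _ _ refl refl = solve q v a′ M₂ M₃ J U B G Dd A T I t′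
      where
      solve : ∀ q v a′ M₂ M₃ J U B G Dd A T I t′ →
        2 ℕ.* q ℕ.* J ℕ.* (M₂ ℕ.* U) ℕ.* (2 ℕ.* a′ ℕ.* (v ℕ.* B)) ℕ.* (G ℕ.* Dd ℕ.* A ℕ.* T ℕ.* I ℕ.* (M₃ ℕ.* t′))
          ≡ 2 ℕ.* v ℕ.* J ℕ.* U ℕ.* B ℕ.* q ℕ.* (2 ℕ.* M₂ ℕ.* (M₃ ℕ.* G) ℕ.* Dd ℕ.* I ℕ.* (a′ ℕ.* A) ℕ.* (t′ ℕ.* T))
      solve = ℕ-Ring.solve-∀

  telescoping-step : partialTerm i t (suc d) + partialTerm i (suc t) d ≡ evenTerm i (suc t) d
  telescoping-step = begin
    partialTerm i t (suc d) + partialTerm i (suc t) d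
      ≡⟨ cong₂ _+_ partialTerm-left partialTerm-right ⟩
    frac (Num ℕ.* 1) (Den ℕ.* s) + frac (Num ℕ.* (d ℕ.* u)) (Den ℕ.* (s ℕ.* M₃ ℕ.* suc t))
      ≡⟨ frac-+ (Den>0 ⊛ suc-pos (t ℕ.+ d)) (Den>0 ⊛ den>0) ⟩
    frac (Num ℕ.* 1 ℕ.* (Den ℕ.* (s ℕ.* M₃ ℕ.* suc t)) ℕ.+ Num ℕ.* (d ℕ.* u) ℕ.* (Den ℕ.* s)) (Den ℕ.* s ℕ.* (Den ℕ.* (s ℕ.* M₃ ℕ.* suc t)))
      ≡⟨ frac-cross (Den>0 ⊛ suc-pos (t ℕ.+ d) ⊛ (Den>0 ⊛ den>0)) (Den>0 ⊛ (suc-pos (suc (suc (M ℕ.+ M))) ⊛ suc-pos t))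
                    (common-factor Num Den s M₃ (suc t) d u ([2k+1] i (suc t)) (key i t d)) ⟩
    frac (Num ℕ.* [2k+1] i (suc t)) (Den ℕ.* (M₃ ℕ.* suc t))
      ≡⟨ sym evenTerm-next ⟩
    evenTerm i (suc t) d ∎
    where
    den>0 : 0 < s ℕ.* M₃ ℕ.* suc t
    den>0 = suc-pos (t ℕ.+ d) ⊛ suc-pos (suc (suc (M ℕ.+ M))) ⊛ suc-pos t
    key : ∀ i t d → suc (suc (suc ((i ℕ.+ suc (t ℕ.+ d) ℕ.+ t) ℕ.+ (i ℕ.+ suc (t ℕ.+ d) ℕ.+ t)))) ℕ.* suc t
                      ℕ.+ d ℕ.* suc (suc (suc ((i ℕ.+ t) ℕ.+ (i ℕ.+ t))))
                    ≡ suc ((i ℕ.+ suc t ℕ.+ suc t) ℕ.+ (i ℕ.+ suc t ℕ.+ suc t)) ℕ.* suc (t ℕ.+ d)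
    key = ℕ-Ring.solve-∀
    common-factor : ∀ Num Den s M₃ t′ d u q → M₃ ℕ.* t′ ℕ.+ d ℕ.* u ≡ q ℕ.* s →
      (Num ℕ.* 1 ℕ.* (Den ℕ.* (s ℕ.* M₃ ℕ.* t′)) ℕ.+ Num ℕ.* (d ℕ.* u) ℕ.* (Den ℕ.* s)) ℕ.* (Den ℕ.* (M₃ ℕ.* t′))
        ≡ Num ℕ.* q ℕ.* (Den ℕ.* s ℕ.* (Den ℕ.* (s ℕ.* M₃ ℕ.* t′)))
    common-factor Num Den s M₃ t′ d u q eq = begin
      (Num ℕ.* 1 ℕ.* (Den ℕ.* (s ℕ.* M₃ ℕ.* t′)) ℕ.+ Num ℕ.* (d ℕ.* u) ℕ.* (Den ℕ.* s)) ℕ.* (Den ℕ.* (M₃ ℕ.* t′))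
        ≡⟨ ℕ-Ring.solve (Num ∷ Den ∷ s ∷ M₃ ∷ t′ ∷ d ∷ u ∷ []) ⟩
      Num ℕ.* Den ℕ.* Den ℕ.* s ℕ.* M₃ ℕ.* t′ ℕ.* (M₃ ℕ.* t′ ℕ.+ d ℕ.* u)
        ≡⟨ cong (Num ℕ.* Den ℕ.* Den ℕ.* s ℕ.* M₃ ℕ.* t′ ℕ.*_) eq ⟩
      Num ℕ.* Den ℕ.* Den ℕ.* s ℕ.* M₃ ℕ.* t′ ℕ.* (q ℕ.* s)
        ≡⟨ ℕ-Ring.solve (Num ∷ Den ∷ s ∷ M₃ ∷ t′ ∷ q ∷ []) ⟩
      Num ℕ.* q ℕ.* (Den ℕ.* s ℕ.* (Den ℕ.* (s ℕ.* M₃ ℕ.* t′))) ∎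

split-parity : ∀ i j → i ≤ j → Σ[ u ∈ ℕ ] j ≡ i +2× u ⊎ Σ[ u ∈ ℕ ] j ≡ suc (i +2× u)
split-parity i j i≤j with parity (j ∸ i)
... | inj₁ (u , even) = inj₁ (u , trans j≡ (trans (cong (i ℕ.+_) (trans even (+2×-spec 0 u))) (sym (+2×-spec i u))))
  where j≡ = sym (ℕP.m+[n∸m]≡n i≤j)
... | inj₂ (u , odd)  = inj₂ (u , trans j≡ (trans (cong (i ℕ.+_) (trans odd (cong suc (+2×-spec 0 u))))
                                              (trans (ℕP.+-suc i (u ℕ.+ u)) (cong suc (sym (+2×-spec i u))))))
  where j≡ = sym (ℕP.m+[n∸m]≡n i≤j)

parity-clash : ∀ i j k u w m → j ≡ suc (i +2× u) → j ≡ k +2× w → i ℕ.+ k ≡ 0 +2× m → ⊥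
parity-clash i j k u w m j-odd j-even i+k-even = even≢odd (w ℕ.+ m) (i ℕ.+ u) (begin
  0 +2× (w ℕ.+ m)                       ≡⟨ +2×-spec 0 (w ℕ.+ m) ⟩
  (w ℕ.+ m) ℕ.+ (w ℕ.+ m)               ≡⟨ regroup w m ⟩
  (w ℕ.+ w) ℕ.+ (m ℕ.+ m)               ≡⟨ cong ((w ℕ.+ w) ℕ.+_) (sym (trans i+k-even (+2×-spec 0 m))) ⟩
  (w ℕ.+ w) ℕ.+ (i ℕ.+ k)               ≡⟨ move w i k ⟩
  i ℕ.+ (k ℕ.+ (w ℕ.+ w))               ≡⟨ cong (i ℕ.+_) (trans (sym (+2×-spec k w)) (sym j-even)) ⟩
  i ℕ.+ j                               ≡⟨ cong (i ℕ.+_) (trans j-odd (cong suc (+2×-spec i u))) ⟩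
  i ℕ.+ suc (i ℕ.+ (u ℕ.+ u))           ≡⟨ collect i u ⟩
  suc ((i ℕ.+ u) ℕ.+ (i ℕ.+ u))         ≡⟨ cong suc (sym (+2×-spec 0 (i ℕ.+ u))) ⟩
  suc (0 +2× (i ℕ.+ u))                 ∎)
  where
  regroup : ∀ w m → (w ℕ.+ m) ℕ.+ (w ℕ.+ m) ≡ (w ℕ.+ w) ℕ.+ (m ℕ.+ m)
  regroup = ℕ-Ring.solve-∀
  move : ∀ w i k → (w ℕ.+ w) ℕ.+ (i ℕ.+ k) ≡ i ℕ.+ (k ℕ.+ (w ℕ.+ w))
  move = ℕ-Ring.solve-∀
  collect : ∀ i u → i ℕ.+ suc (i ℕ.+ (u ℕ.+ u)) ≡ suc ((i ℕ.+ u) ℕ.+ (i ℕ.+ u))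
  collect = ℕ-Ring.solve-∀

coeff-zero : ∀ j i k → monomialCoeff j k ≡ 0ℚ → monomialTerm j i k ≡ 0ℚ
coeff-zero j i k g≡0 = trans (cong (λ g → weight k * g * Legendre k i) g≡0)
                             (trans (cong (_* Legendre k i) (ℚP.*-zeroʳ (weight k))) (ℚP.*-zeroˡ (Legendre k i)))

legendre-zero : ∀ j i k → Legendre k i ≡ 0ℚ → monomialTerm j i k ≡ 0ℚ
legendre-zero j i k P≡0 = trans (cong (weight k * monomialCoeff j k *_) P≡0) (ℚP.*-zeroʳ (weight k * monomialCoeff j k))

monomial-truncate : ∀ N j i → j ≤ N → sumTo N (monomialTerm j i) ≡ sumTo j (monomialTerm j i)
monomial-truncate N j i j≤N = sumTo-truncate j N j≤N (λ k j<k _ → coeff-zero j i k (monomialCoeff-below j k j<k))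

monomial-even-sum : ∀ i s → sumTo (i +2× s) (monomialTerm (i +2× s) i) ≡ sumTo s (λ t → sgn t * evenTerm i t (s ∸ t))
monomial-even-sum i s = begin
  sumTo (i +2× s) (monomialTerm (i +2× s) i)
    ≡⟨ sumTo-even-support i s (λ k k<i → legendre-zero j i k (legendre-above-degree k i k<i))
                              (λ t → legendre-zero j i (suc (i +2× t)) (legendre-odd (suc (i +2× t)) i (i ℕ.+ t) (odd t))) ⟩
  sumTo s (λ t → monomialTerm j i (i +2× t))
    ≡⟨ sumTo-cong s (λ t t≤s → trans (cong (λ j′ → monomialTerm j′ i (i +2× t)) (split t t≤s)) (monomialTerm-even i t (s ∸ t))) ⟩
  sumTo s (λ t → sgn t * evenTerm i t (s ∸ t)) ∎
  where
  j : ℕ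
  j = i +2× s
  split : ∀ t → t ≤ s → j ≡ (i +2× t) +2× (s ∸ t)
  split t t≤s = trans (cong (i +2×_) (sym (ℕP.m+[n∸m]≡n t≤s))) (+2×-+ i t (s ∸ t))
  odd : ∀ t → i ℕ.+ suc (i +2× t) ≡ suc (0 +2× (i ℕ.+ t))
  odd t = begin
    i ℕ.+ suc (i +2× t)            ≡⟨ cong (λ m → i ℕ.+ suc m) (+2×-spec i t) ⟩
    i ℕ.+ suc (i ℕ.+ (t ℕ.+ t))    ≡⟨ collect i t ⟩
    suc ((i ℕ.+ t) ℕ.+ (i ℕ.+ t))  ≡⟨ cong suc (sym (+2×-spec 0 (i ℕ.+ t))) ⟩
    suc (0 +2× (i ℕ.+ t))          ∎
    where
    collect : ∀ i t → i ℕ.+ suc (i ℕ.+ (t ℕ.+ t)) ≡ suc ((i ℕ.+ t) ℕ.+ (i ℕ.+ t))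
    collect = ℕ-Ring.solve-∀

-- For j = i + 2(s+1) the alternating sum telescopes to (-1)^{s+1} partialTerm i (s+1) 0 = 0.
evenTerm-alternating-sum : ∀ i s → sumTo (suc s) (λ t → sgn t * evenTerm i t (suc s ∸ t)) ≡ 0ℚ
evenTerm-alternating-sum i s = begin
  sumTo (suc s) (λ t → sgn t * F t)          ≡⟨ alternating-telescope (suc s) F A (evenTerm-first i s) step ⟩
  sgn (suc s) * partialTerm i (suc s) (s ∸ s) ≡⟨ cong (λ d → sgn (suc s) * partialTerm i (suc s) d) (ℕP.n∸n≡0 s) ⟩
  sgn (suc s) * partialTerm i (suc s) 0       ≡⟨ cong (sgn (suc s) *_) (partialTerm-end i (suc s)) ⟩
  sgn (suc s) * 0ℚ                            ≡⟨ ℚP.*-zeroʳ (sgn (suc s)) ⟩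
  0ℚ                                          ∎
  where
  F A : ℕ → ℚ
  F t = evenTerm i t (suc s ∸ t)
  A t = partialTerm i t (suc s ∸ t)
  step : ∀ t → t < suc s → F (suc t) ≡ A t + A (suc t)
  step t (s≤s t≤s) = begin
    evenTerm i (suc t) (s ∸ t)
      ≡⟨ sym (telescoping-step i t (s ∸ t)) ⟩
    partialTerm i t (suc (s ∸ t)) + partialTerm i (suc t) (s ∸ t)
      ≡⟨ cong (λ d → partialTerm i t d + partialTerm i (suc t) (s ∸ t)) (sym (ℕP.+-∸-assoc 1 t≤s)) ⟩
    A t + A (suc t) ∎

monomial-diagonal : ∀ N i → i ≤ N → sumTo N (monomialTerm i i) ≡ 1ℚ
monomial-diagonal N i i≤N = begin
  sumTo N (monomialTerm i i)  ≡⟨ monomial-truncate N i i i≤N ⟩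
  sumTo i (monomialTerm i i)  ≡⟨ monomial-even-sum i 0 ⟩
  1ℚ * evenTerm i 0 0         ≡⟨ ℚP.*-identityˡ (evenTerm i 0 0) ⟩
  evenTerm i 0 0              ≡⟨ evenTerm-origin i ⟩
  1ℚ                          ∎

monomial-off-diagonal : ∀ N j i → j ≤ N → j ≢ i → sumTo N (monomialTerm j i) ≡ 0ℚ
monomial-off-diagonal N j i j≤N j≢i = trans (monomial-truncate N j i j≤N) (vanishes (j ℕ.<? i))
  where
  vanishes : Dec (j < i) → sumTo j (monomialTerm j i) ≡ 0ℚ
  vanishes (yes j<i) = sumTo-zero j (λ k k≤j → legendre-zero j i k (legendre-above-degree k i (ℕP.≤-<-trans k≤j j<i)))
  vanishes (no j≮i) with split-parity i j (ℕP.≮⇒≥ j≮i)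
  ... | inj₁ (zero  , j≡i)  = ⊥-elim (j≢i j≡i)
  ... | inj₁ (suc s , refl) = trans (monomial-even-sum i (suc s)) (evenTerm-alternating-sum i s)
  ... | inj₂ (u , j-odd)    = sumTo-zero j termwise
    where
    termwise : ∀ k → k ≤ j → monomialTerm j i k ≡ 0ℚ
    termwise k k≤j with split-parity k j k≤j | parity (i ℕ.+ k)
    ... | inj₂ (w , j≡k+odd) | _ = coeff-zero j i k (trans (cong (λ j′ → monomialCoeff j′ k) j≡k+odd) (monomialCoeff-odd k w))
    ... | inj₁ _ | inj₂ (m , i+k-odd) = legendre-zero j i k (legendre-odd k i m i+k-odd)
    ... | inj₁ (w , j≡k+even) | inj₁ (m , i+k-even) = ⊥-elim (parity-clash i j k u w m j-odd j≡k+even i+k-even)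

hermiteCoeff : ℕ → ℕ → ℚ
hermiteCoeff n j = ⟦ 2 ^ j ℕ.* (n C j) ⟧ * HermiteNum (n ∸ j)

hermite-is-hermiteCoeff : ∀ n i → i ≤ n → Hermite n i ≡ hermiteCoeff n i
hermite-is-hermiteCoeff n i i≤n = begin
  Hermite n i                                            ≡⟨ cong (λ m → Hermite m i) (sym n-i+i≡n) ⟩
  Hermite (n ∸ i ℕ.+ i) i                                ≡⟨ hermite-coeff (n ∸ i) i ⟩
  ⟦ ((n ∸ i ℕ.+ i) C i) ℕ.* 2 ^ i ⟧ * HermiteNum (n ∸ i) ≡⟨ cong (λ m → ⟦ m ⟧ * HermiteNum (n ∸ i)) swap ⟩
  hermiteCoeff n i                                       ∎
  where
  n-i+i≡n : n ∸ i ℕ.+ i ≡ n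
  n-i+i≡n = ℕP.m∸n+n≡m i≤n
  swap : ((n ∸ i ℕ.+ i) C i) ℕ.* 2 ^ i ≡ 2 ^ i ℕ.* (n C i)
  swap = trans (cong (λ m → (m C i) ℕ.* 2 ^ i) n-i+i≡n) (ℕP.*-comm (n C i) (2 ^ i))

term-factor : ∀ n k j → term n k j ≡ ⟦ 2 ^ j ℕ.* (n C j) ⟧ * (monomialCoeff j k * HermiteNum (n ∸ j))
term-factor n k j = split (j <ᵇ k) (((j ∸ k) % 2) ≡ᵇ 0) pull-out
  where
  c a b : ℕ
  c = 2 ^ j ℕ.* (n C j)
  a = (j !) ℕ.* (((j ℕ.+ k ℕ.+ 2) / 2) !)
  b = ((j ℕ.+ k ℕ.+ 2) !) ℕ.* (((j ∸ k) / 2) !)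
  h : ℚ
  h = HermiteNum (n ∸ j)
  pull-out : frac (c ℕ.* (j !) ℕ.* (((j ℕ.+ k ℕ.+ 2) / 2) !)) b ≡ ⟦ c ⟧ * frac a b
  pull-out = begin
    frac (c ℕ.* (j !) ℕ.* (((j ℕ.+ k ℕ.+ 2) / 2) !)) b ≡⟨ cong₂ frac (ℕP.*-assoc c (j !) _) (sym (ℕP.*-identityˡ b)) ⟩
    frac (c ℕ.* a) (1 ℕ.* b)                          ≡⟨ sym (frac-* c 1 a b) ⟩
    ⟦ c ⟧ * frac a b                                  ∎
  split : ∀ (b₁ b₂ : Bool) {A B : ℚ} → A ≡ ⟦ c ⟧ * B →
    (if b₁ then 0ℚ else if b₂ then A * h else 0ℚ) ≡ ⟦ c ⟧ * ((if b₁ then 0ℚ else if b₂ then B else 0ℚ) * h)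
  split true  _     _  = sym (trans (cong (⟦ c ⟧ *_) (ℚP.*-zeroˡ h)) (ℚP.*-zeroʳ ⟦ c ⟧))
  split false true  eq = trans (cong (_* h) eq) (ℚP.*-assoc ⟦ c ⟧ _ h)
  split false false _  = sym (trans (cong (⟦ c ⟧ *_) (ℚP.*-zeroˡ h)) (ℚP.*-zeroʳ ⟦ c ⟧))

coeff-times-legendre : ∀ n k i → coeff n k * Legendre k i ≡ sumTo n (λ j → hermiteCoeff n j * monomialTerm j i k)
coeff-times-legendre n k i = begin
  weight k * sumTo n (term n k) * Legendre k i
    ≡⟨ cong (λ x → weight k * x * Legendre k i) (sumTo-cong n (λ j _ → term-factor n k j)) ⟩
  weight k * sumTo n (λ j → ⟦ c j ⟧ * (monomialCoeff j k * h j)) * Legendre k i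
    ≡⟨ cong (_* Legendre k i) (sym (sumTo-*ˡ n (weight k) _)) ⟩
  sumTo n (λ j → weight k * (⟦ c j ⟧ * (monomialCoeff j k * h j))) * Legendre k i
    ≡⟨ sym (sumTo-*ʳ n (Legendre k i) _) ⟩
  sumTo n (λ j → weight k * (⟦ c j ⟧ * (monomialCoeff j k * h j)) * Legendre k i)
    ≡⟨ sumTo-cong n (λ j _ → regroup (weight k) ⟦ c j ⟧ (monomialCoeff j k) (h j) (Legendre k i)) ⟩
  sumTo n (λ j → hermiteCoeff n j * monomialTerm j i k) ∎
  where
  c : ℕ → ℕ
  c j = 2 ^ j ℕ.* (n C j)
  h : ℕ → ℚ
  h j = HermiteNum (n ∸ j)
  regroup : ∀ (w c g h ℓ : ℚ) → w * (c * (g * h)) * ℓ ≡ c * h * (w * g * ℓ)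
  regroup = solve-∀ ℚ-ring

rhs-coefficient : ∀ n i → sumPoly n (λ k → coeff n k ·ₚ Legendre k) i ≡ sumTo n (λ j → hermiteCoeff n j * sumTo n (monomialTerm j i))
rhs-coefficient n i = begin
  sumTo n (λ k → coeff n k * Legendre k i)
    ≡⟨ sumTo-cong n (λ k _ → coeff-times-legendre n k i) ⟩
  sumTo n (λ k → sumTo n (λ j → hermiteCoeff n j * monomialTerm j i k))
    ≡⟨ sumTo-swap n n (λ k j → hermiteCoeff n j * monomialTerm j i k) ⟩
  sumTo n (λ j → sumTo n (λ k → hermiteCoeff n j * monomialTerm j i k))
    ≡⟨ sumTo-cong n (λ j _ → sumTo-*ˡ n (hermiteCoeff n j) (monomialTerm j i)) ⟩
  sumTo n (λ j → hermiteCoeff n j * sumTo n (monomialTerm j i)) ∎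

theorem2 : (n : ℕ) → Hermite n ≈ₚ sumPoly n (λ k → coeff n k ·ₚ Legendre k)
theorem2 n i with i ℕ.≤? n
... | yes i≤n = sym (begin
  sumPoly n (λ k → coeff n k ·ₚ Legendre k) i
    ≡⟨ rhs-coefficient n i ⟩
  sumTo n (λ j → hermiteCoeff n j * sumTo n (monomialTerm j i))
    ≡⟨ sumTo-single n i i≤n (λ j j≤n j≢i → trans (cong (hermiteCoeff n j *_) (monomial-off-diagonal n j i j≤n j≢i))
                                                 (ℚP.*-zeroʳ (hermiteCoeff n j))) ⟩
  hermiteCoeff n i * sumTo n (monomialTerm i i)
    ≡⟨ trans (cong (hermiteCoeff n i *_) (monomial-diagonal n i i≤n)) (ℚP.*-identityʳ (hermiteCoeff n i)) ⟩
  hermiteCoeff n i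
    ≡⟨ sym (hermite-is-hermiteCoeff n i i≤n) ⟩
  Hermite n i ∎)
... | no i≰n = begin
  Hermite n i
    ≡⟨ hermite-above-degree n i (ℕP.≰⇒> i≰n) ⟩
  0ℚ
    ≡⟨ sym (sumTo-zero n (λ j j≤n → trans (cong (hermiteCoeff n j *_) (monomial-off-diagonal n j i j≤n (λ { refl → i≰n j≤n })))
                                          (ℚP.*-zeroʳ (hermiteCoeff n j)))) ⟩
  sumTo n (λ j → hermiteCoeff n j * sumTo n (monomialTerm j i))
    ≡⟨ sym (rhs-coefficient n i) ⟩
  sumPoly n (λ k → coeff n k ·ₚ Legendre k) i ∎
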